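{- Let $n, m$ be positive integers and $p$ a prime. Let $T_{n,m} = \sum_{i=0}^{m-1} S_n^i = I_n + S_n + \cdots + S_n^{m-1}$. Then $T_{n,m}$ is nilpotent over $\mathbb{Z}_p$ if and only if (i) $p \mid m$ and (ii) $n \mid m p^k$ for some integer $k \geq 0$. Moreover, when these conditions hold, the nilpotent index of $T_{n,m}$ over $\mathbb{Z}_p$ equals $\left\lceil \frac{p^a}{p^b - 1} \right\rceil$, where $a$ and $b$ are the largest integers with $p^a \mid n$ and $p^b \mid m$, respectively.
   Context: $I_n$ is the $n\times n$ identity matrix and $S_n$ is the fundamental circulant matrix of order $n$, i.e. the $n\times n$ permutation matrix with $(S_n)_{i,j} = 1$ if $j \equiv i+1 \pmod n$ and $0$ otherwise (so $S_n^n = I_n$). $\mathbb{Z}_p$ is the field of residues modulo $p$; an integer matrix $M$ is nilpotent over $\mathbb{Z}_p$ if $M^k \equiv 0 \pmod p$ (entrywise) for some $k>0$, and the nilpotent index is the least such $k$. -}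

module Defs where

open import Data.Nat using (ℕ; zero; suc; _+_; _*_; _∸_; _^_; _<_; _≤_; _%_; _/_; _≟_)
open import Data.Nat.Divisibility using (_∣_)
open import Data.Fin using (Fin; toℕ)
import Data.Fin as F
open import Data.Bool using (if_then_else_)
open import Data.Product using (_×_; ∃-syntax)
open import Relation.Nullary using (¬_)
open import Relation.Nullary.Decidable using (⌊_⌋)
open import Relation.Binary.PropositionalEquality using (_≡_)

-- integer square matrices of order n (entries in ℕ suffice: all matrices here
-- have nonnegative integer entries), as functions of row/column index
Mat : ℕ → Set
Mat n = Fin n → Fin n → ℕ

sumFin : ∀ {n} → (Fin n → ℕ) → ℕ
sumFin {zero}  f = 0
sumFin {suc n} f = f F.zero + sumFin (λ i → f (F.suc i))

_⊗_ : ∀ {n} → Mat n → Mat n → Mat n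
(A ⊗ B) i j = sumFin (λ k → A i k * B k j)

_⊕_ : ∀ {n} → Mat n → Mat n → Mat n
(A ⊕ B) i j = A i j + B i j

zeroMat : ∀ n → Mat n
zeroMat n i j = 0

I : ∀ n → Mat n
I n i j = if ⌊ toℕ i ≟ toℕ j ⌋ then 1 else 0

S : ∀ n → Mat n
S zero    ()
S (suc n) i j = if ⌊ toℕ j ≟ suc (toℕ i) % suc n ⌋ then 1 else 0

_^ᴹ_ : ∀ {n} → Mat n → ℕ → Mat n
_^ᴹ_ {n} A zero    = I n
_^ᴹ_ {n} A (suc k) = A ⊗ (A ^ᴹ k)

powSum : ∀ {n} → Mat n → ℕ → Mat n
powSum {n} A zero    = zeroMat n
powSum {n} A (suc m) = powSum A m ⊕ (A ^ᴹ m)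

T : (n m : ℕ) → Mat n
T n m = powSum (S n) m

ZeroMod : ℕ → ∀ {n} → Mat n → Set
ZeroMod p A = ∀ i j → p ∣ A i j

NilpotentMod : ℕ → ∀ {n} → Mat n → Set
NilpotentMod p A = ∃[ k ] (0 < k × ZeroMod p (A ^ᴹ k))

NilIndexMod : ℕ → ∀ {n} → Mat n → ℕ → Set
NilIndexMod p A k = 0 < k × ZeroMod p (A ^ᴹ k)
                  × (∀ j → 0 < j → j < k → ¬ ZeroMod p (A ^ᴹ j))

IsMaxPowDiv : ℕ → ℕ → ℕ → Set
IsMaxPowDiv p n a = (p ^ a) ∣ n × ¬ ((p ^ suc a) ∣ n)

-- ceiling division ⌈x / y⌉ (value for y = 0 is irrelevant; set to 0)
ceilDiv : ℕ → ℕ → ℕ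
ceilDiv x zero    = 0
ceilDiv x (suc y) = (x + y) / suc y

-- Read modulo p, the polynomials in the circulant S_n form the commutative ring ℤ_p[x]/(xⁿ − 1), in which
-- T_{n,m} is the geometric sum 1 + x + ⋯ + x^(m−1). Two characteristic-p identities drive the argument:
-- (1 + w)^(p^a) = 1 + w^(p^a), and 1 + (1 + w) + ⋯ + (1 + w)^(p^a − 1) = w^(p^a − 1). Writing m = m′p^b,
-- they give T_{n,m} = T_{n,m′} · (x^m′ − 1)^(p^b − 1).
-- If n = n′p^a with p ∤ n′ ∣ m′, then x^m′ − 1 is a multiple of x^n′ − 1, whose p^a-th power is xⁿ − 1 = 0;
-- hence T^k = 0 as soon as (p^b − 1)k ≥ p^a. Conversely, T^k = 0 makes (x^m − 1)^k = (x − 1)^k T^k vanish,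
-- so x^(mp^k) = 1, that is n ∣ mp^k; and in the quotient by x − 1 the matrix T becomes m, so p ∣ m.
-- For the lower bound pass to the quotient ℤ_p[x]/(x^(p^a) − 1). There u = x − 1 has u^(p^a) = 0,
-- T_{m′} = m′ + u·(…) is a unit, and T^j = u^((p^b − 1)j)·(unit), which is nonzero while (p^b − 1)j < p^a
-- because u^(p^a − 1) = T_{p^a} has entry 1 at (0, 0).

module Submission where

open import Defs
open import Data.Nat
  using (ℕ; zero; suc; pred; _+_; _*_; _∸_; _^_; _<_; _≤_; _%_; _≟_; NonZero; z≤n; s≤s; s≤s⁻¹; nonTrivial⇒n>1; >-nonZero)
import Data.Nat.Properties as ℕ
open import Data.Nat.DivMod
  using (m≡m%n+[m/n]*n; m≥n⇒m/n>0; %-distribˡ-+; %-distribˡ-*; m*n%n≡0; m%n%n≡m%n; m%n<n; m<n⇒m%n≡m; [m+n]%n≡m%n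
        ; m∣n⇒o%n%m≡o%m)
open import Data.Nat.Divisibility
  using (_∣_; divides; _∣?_; ∣-trans; 1∣_; _∣0; ∣1⇒≡1; ∣⇒≤; ∣m∣n⇒∣m+n; ∣m⇒∣m*n; m%n≡0⇒n∣m; n∣m⇒m%n≡0)
open import Data.Nat.Coprimality using (Coprime; coprime-divisor)
open import Data.Nat.Primality using (Prime; euclidsLemma; prime⇒irreducible; prime⇒nonTrivial; prime⇒nonZero)
open import Data.Nat.Combinatorics using (_C_; nC1≡n; nCn≡1; k>n⇒nCk≡0; nCk+nC[k+1]≡[n+1]C[k+1])
open import Data.Nat.Induction using (<-rec)
open import Data.Fin using (Fin; toℕ; fromℕ<)
import Data.Fin as F
import Data.Fin.Properties as FP
open import Data.Bool using (if_then_else_)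
open import Data.Empty using (⊥-elim)
open import Data.Product using (_×_; _,_; ∃-syntax)
open import Data.Sum using (inj₁; inj₂)
open import Function.Base using (_∘_)
open import Function.Bundles using (_⇔_; mk⇔; Equivalence)
open import Relation.Nullary using (¬_; yes; no)
open import Relation.Nullary.Decidable using (⌊_⌋)
open import Relation.Binary.PropositionalEquality
  using (_≡_; _≢_; refl; sym; trans; cong; cong₂; subst; module ≡-Reasoning)
open import Relation.Binary.Bundles using (Setoid)
import Relation.Binary.Reasoning.Setoid as SetoidReasoning
open import Algebra.Bundles using (CommutativeRing)
open import Algebra.Structures using (IsCommutativeRing)
open import Algebra.Properties.CommutativeSemigroup ℕ.*-commutativeSemigroup
  using () renaming (x∙yz≈y∙xz to m*[n*o]≡n*[m*o])
open import Algebra.Properties.Semiring.Sum ℕ.+-*-semiring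
  using (sum; ∑-distrib-+; ∑-comm; *-distribˡ-sum; *-distribʳ-sum; sum-replicate-zero)

[P∸1]+P*q≡[1+q]*P∸1 : ∀ P q → 0 < P → (P ∸ 1) + P * q ≡ suc q * P ∸ 1
[P∸1]+P*q≡[1+q]*P∸1 (suc Q) q _ = cong (Q +_) (ℕ.*-comm (suc Q) q)

prime⇒1<p : ∀ {p} → Prime p → 1 < p
prime⇒1<p {p} p-prime = nonTrivial⇒n>1 p {{prime⇒nonTrivial p-prime}}

n<m^n : ∀ {m} → 1 < m → ∀ n → n < m ^ n
n<m^n 1<m zero    = s≤s z≤n
n<m^n {m} 1<m (suc n) = begin-strict
  suc n      ≤⟨ n<m^n 1<m n ⟩
  m ^ n      <⟨ ℕ.m<m*n (m ^ n) m {{ℕ.m^n≢0 m n}} 1<m ⟩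
  m ^ n * m  ≡⟨ ℕ.*-comm (m ^ n) m ⟩
  m * m ^ n  ∎
  where
  open ℕ.≤-Reasoning
  instance _ = >-nonZero (ℕ.<-trans (s≤s z≤n) 1<m)

[1+k]*[1+n]C[1+k]≡[1+n]*nCk : ∀ n k → suc k * (suc n C suc k) ≡ suc n * (n C k)
[1+k]*[1+n]C[1+k]≡[1+n]*nCk zero    zero    = refl
[1+k]*[1+n]C[1+k]≡[1+n]*nCk zero    (suc k) = ℕ.*-zeroʳ (suc (suc k))
[1+k]*[1+n]C[1+k]≡[1+n]*nCk (suc n) zero    =
  trans (ℕ.*-identityˡ _) (trans (nC1≡n (suc (suc n))) (sym (ℕ.*-identityʳ (suc (suc n)))))
[1+k]*[1+n]C[1+k]≡[1+n]*nCk (suc n) (suc k) = begin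
  suc (suc k) * (suc (suc n) C suc (suc k))
    ≡⟨ cong (suc (suc k) *_) (nCk+nC[k+1]≡[n+1]C[k+1] (suc n) (suc k)) ⟨
  suc (suc k) * (a + b)                       ≡⟨ ℕ.*-distribˡ-+ (suc (suc k)) a b ⟩
  (a + suc k * a) + suc (suc k) * b           ≡⟨ cong₂ (λ u v → (a + u) + v) ([1+k]*[1+n]C[1+k]≡[1+n]*nCk n k)
                                                                            ([1+k]*[1+n]C[1+k]≡[1+n]*nCk n (suc k)) ⟩
  (a + suc n * (n C k)) + suc n * (n C suc k) ≡⟨ ℕ.+-assoc a _ _ ⟩
  a + (suc n * (n C k) + suc n * (n C suc k)) ≡⟨ cong (a +_) (ℕ.*-distribˡ-+ (suc n) (n C k) (n C suc k)) ⟨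
  a + suc n * (n C k + n C suc k)             ≡⟨ cong (λ c → a + suc n * c) (nCk+nC[k+1]≡[n+1]C[k+1] n k) ⟩
  a + suc n * a                               ∎
  where
  open ≡-Reasoning
  a = suc n C suc k
  b = suc n C suc (suc k)

prime∣pCk : ∀ {p k} → Prime p → 0 < k → k < p → p ∣ p C k
prime∣pCk {suc p₁} {suc k} p-prime _ k<p
  with euclidsLemma (suc k) (suc p₁ C suc k) p-prime
         (divides (p₁ C k) (trans ([1+k]*[1+n]C[1+k]≡[1+n]*nCk p₁ k) (ℕ.*-comm (suc p₁) (p₁ C k))))
... | inj₂ p∣pCk = p∣pCk
... | inj₁ p∣k   = ⊥-elim (ℕ.<⇒≱ k<p (∣⇒≤ p∣k))

module _ {p : ℕ} (p-prime : Prime p) where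
  private
    instance _ = prime⇒nonZero p-prime

  prime∣^⇒prime∣ : ∀ m k → p ∣ m ^ k → p ∣ m
  prime∣^⇒prime∣ m zero    p∣1 = ⊥-elim (ℕ.<⇒≢ (prime⇒1<p p-prime) (sym (∣1⇒≡1 p∣1)))
  prime∣^⇒prime∣ m (suc k) p∣mᵏ⁺¹ with euclidsLemma m (m ^ k) p-prime p∣mᵏ⁺¹
  ... | inj₁ p∣m  = p∣m
  ... | inj₂ p∣mᵏ = prime∣^⇒prime∣ m k p∣mᵏ

  ∤prime⇒coprime : ∀ {n} → ¬ p ∣ n → Coprime n p
  ∤prime⇒coprime p∤n (d∣n , d∣p) with prime⇒irreducible p-prime d∣p
  ... | inj₁ d≡1 = d≡1
  ... | inj₂ refl = ⊥-elim (p∤n d∣n)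

  coprime-divisor-^ : ∀ {n} m e → ¬ p ∣ n → n ∣ m * p ^ e → n ∣ m
  coprime-divisor-^ {n} m zero    p∤n n∣m*1 = subst (n ∣_) (ℕ.*-identityʳ m) n∣m*1
  coprime-divisor-^ {n} m (suc e) p∤n n∣m*pᵉ⁺¹ =
    coprime-divisor-^ m e p∤n (coprime-divisor (∤prime⇒coprime p∤n) (subst (n ∣_) (m*[n*o]≡n*[m*o] m p (p ^ e)) n∣m*pᵉ⁺¹))

  p-free-part : ∀ n → 0 < n → ∃[ a ] ∃[ n′ ] (n ≡ n′ * p ^ a × ¬ p ∣ n′)
  p-free-part = <-rec (λ n → 0 < n → ∃[ a ] ∃[ n′ ] (n ≡ n′ * p ^ a × ¬ p ∣ n′)) split
    where
    positive-factor : ∀ c → 0 < c * p → 0 < c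
    positive-factor (suc c) _ = s≤s z≤n

    c<c*p : ∀ c → 0 < c * p → c < c * p
    c<c*p c 0<c*p = ℕ.m<m*n c p {{>-nonZero (positive-factor c 0<c*p)}} (prime⇒1<p p-prime)

    n′*pᵃ*p≡n′*pᵃ⁺¹ : ∀ n′ a → n′ * p ^ a * p ≡ n′ * (p * p ^ a)
    n′*pᵃ*p≡n′*pᵃ⁺¹ n′ a = trans (ℕ.*-assoc n′ (p ^ a) p) (cong (n′ *_) (ℕ.*-comm (p ^ a) p))

    split : ∀ n → (∀ {m} → m < n → 0 < m → ∃[ a ] ∃[ n′ ] (m ≡ n′ * p ^ a × ¬ p ∣ n′)) →
            0 < n → ∃[ a ] ∃[ n′ ] (n ≡ n′ * p ^ a × ¬ p ∣ n′)
    split n rec 0<n with p ∣? n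
    ... | no p∤n = 0 , n , sym (ℕ.*-identityʳ n) , p∤n
    ... | yes (divides c refl) =
      let a , n′ , c≡n′*pᵃ , p∤n′ = rec (c<c*p c 0<n) (positive-factor c 0<n)
      in suc a , n′ , trans (cong (_* p) c≡n′*pᵃ) (n′*pᵃ*p≡n′*pᵃ⁺¹ n′ a) , p∤n′

  p∣m⇒0<b : ∀ {m m′} b → m ≡ m′ * p ^ b → ¬ p ∣ m′ → p ∣ m → 0 < b
  p∣m⇒0<b zero    m≡m′*1 p∤m′ p∣m = ⊥-elim (p∤m′ (subst (p ∣_) (trans m≡m′*1 (ℕ.*-identityʳ _)) p∣m))
  p∣m⇒0<b (suc b) _      _    _   = s≤s z≤n

  0<pᵇ∸1 : ∀ b → 0 < b → 0 < p ^ b ∸ 1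
  0<pᵇ∸1 (suc b) _ = ℕ.m<n⇒0<n∸m (ℕ.<-≤-trans (prime⇒1<p p-prime) (ℕ.m≤m*n p (p ^ b) {{ℕ.m^n≢0 p b}}))

maxPowDiv-split : ∀ {p n} a → IsMaxPowDiv p n a → ∃[ n′ ] (n ≡ n′ * p ^ a × ¬ p ∣ n′)
maxPowDiv-split {p} {n} a (divides n′ n≡n′*pᵃ , ¬pᵃ⁺¹∣n) = n′ , n≡n′*pᵃ , p∤n′
  where
  p∤n′ : ¬ p ∣ n′
  p∤n′ (divides c n′≡c*p) = ¬pᵃ⁺¹∣n (divides c (trans n≡n′*pᵃ (trans (cong (_* p ^ a) n′≡c*p) (ℕ.*-assoc c p (p ^ a)))))

private
  N+d≡[N+d]%D+⌈N/D⌉*D : ∀ N d → N + d ≡ (N + d) % suc d + ceilDiv N (suc d) * suc d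
  N+d≡[N+d]%D+⌈N/D⌉*D N d = m≡m%n+[m/n]*n (N + d) (suc d)

ceilDiv-pos : ∀ {N D} → 0 < N → 0 < D → 0 < ceilDiv N D
ceilDiv-pos {N} {suc d} 0<N _ = m≥n⇒m/n>0 {N + d} {suc d} (ℕ.+-monoˡ-≤ d 0<N)

≤ceilDiv* : ∀ {N D} → 0 < D → N ≤ ceilDiv N D * D
≤ceilDiv* {N} {suc d} _ = ℕ.+-cancelʳ-≤ d N _ (begin
  N + d                              ≡⟨ N+d≡[N+d]%D+⌈N/D⌉*D N d ⟩
  (N + d) % suc d + ceilDiv N D * D  ≤⟨ ℕ.+-monoˡ-≤ _ (s≤s⁻¹ (m%n<n (N + d) (suc d))) ⟩
  d + ceilDiv N D * D                ≡⟨ ℕ.+-comm d _ ⟩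
  ceilDiv N D * D + d                ∎)
  where
  open ℕ.≤-Reasoning
  D = suc d

<ceilDiv⇒*< : ∀ {N D} → 0 < D → ∀ j → j < ceilDiv N D → j * D < N
<ceilDiv⇒*< {N} {suc d} _ j j<⌈N/D⌉ = ℕ.+-cancelʳ-< d (j * D) N (begin-strict
  j * D + d                          <⟨ ℕ.+-monoʳ-< (j * D) (ℕ.n<1+n d) ⟩
  j * D + D                          ≡⟨ ℕ.+-comm (j * D) D ⟩
  suc j * D                          ≤⟨ ℕ.*-monoˡ-≤ D j<⌈N/D⌉ ⟩
  ceilDiv N D * D                    ≤⟨ ℕ.m≤n+m _ ((N + d) % D) ⟩
  (N + d) % D + ceilDiv N D * D      ≡⟨ N+d≡[N+d]%D+⌈N/D⌉*D N d ⟨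
  N + d                              ∎)
  where
  open ℕ.≤-Reasoning
  D = suc d

[m%n+o]%n≡[m+o]%n : ∀ m o n .{{_ : NonZero n}} → (m % n + o) % n ≡ (m + o) % n
[m%n+o]%n≡[m+o]%n m o n = begin
  (m % n + o) % n            ≡⟨ %-distribˡ-+ (m % n) o n ⟩
  (m % n % n + o % n) % n    ≡⟨ cong (λ r → (r + o % n) % n) (m%n%n≡m%n m n) ⟩
  (m % n + o % n) % n        ≡⟨ %-distribˡ-+ m o n ⟨
  (m + o) % n                ∎
  where open ≡-Reasoning

[o+m%n]%n≡[o+m]%n : ∀ o m n .{{_ : NonZero n}} → (o + m % n) % n ≡ (o + m) % n
[o+m%n]%n≡[o+m]%n o m n = begin
  (o + m % n) % n   ≡⟨ cong (_% n) (ℕ.+-comm o (m % n)) ⟩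
  (m % n + o) % n   ≡⟨ [m%n+o]%n≡[m+o]%n m o n ⟩
  (m + o) % n       ≡⟨ cong (_% n) (ℕ.+-comm m o) ⟩
  (o + m) % n       ∎
  where open ≡-Reasoning

-- Finite sums and matrices

-- The form in which Defs writes I and S, so that I n i j is δ (toℕ i) (toℕ j) by definition.
δ : ℕ → ℕ → ℕ
δ a b = if ⌊ a ≟ b ⌋ then 1 else 0

δ-≡ : ∀ {a b} → a ≡ b → δ a b ≡ 1
δ-≡ {a} {b} a≡b with a ≟ b
... | yes _  = refl
... | no a≢b = ⊥-elim (a≢b a≡b)

δ-≢ : ∀ {a b} → a ≢ b → δ a b ≡ 0
δ-≢ {a} {b} a≢b with a ≟ b
... | yes a≡b = ⊥-elim (a≢b a≡b)
... | no _    = refl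

δ-sym : ∀ a b → δ a b ≡ δ b a
δ-sym a b with a ≟ b
... | yes a≡b = sym (δ-≡ (sym a≡b))
... | no a≢b  = sym (δ-≢ (a≢b ∘ sym))

δ-suc : ∀ a b → δ (suc a) (suc b) ≡ δ a b
δ-suc a b with a ≟ b
... | yes a≡b = δ-≡ (cong suc a≡b)
... | no a≢b  = δ-≢ (λ e → a≢b (ℕ.suc-injective e))

sumFin≡sum : ∀ {n} (f : Fin n → ℕ) → sumFin f ≡ sum f
sumFin≡sum {zero}  f = refl
sumFin≡sum {suc n} f = cong (f F.zero +_) (sumFin≡sum (λ i → f (F.suc i)))

sumFin-cong : ∀ {n} {f g : Fin n → ℕ} → (∀ i → f i ≡ g i) → sumFin f ≡ sumFin g
sumFin-cong {zero}  f≗g = refl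
sumFin-cong {suc n} f≗g = cong₂ _+_ (f≗g F.zero) (sumFin-cong (λ i → f≗g (F.suc i)))

sumFin-zero : ∀ n → sumFin {n} (λ _ → 0) ≡ 0
sumFin-zero n = trans (sumFin≡sum {n} (λ _ → 0)) (sum-replicate-zero n)

sumFin-distrib-+ : ∀ {n} (f g : Fin n → ℕ) → sumFin (λ i → f i + g i) ≡ sumFin f + sumFin g
sumFin-distrib-+ f g = begin
  sumFin (λ i → f i + g i) ≡⟨ sumFin≡sum (λ i → f i + g i) ⟩
  sum (λ i → f i + g i)    ≡⟨ ∑-distrib-+ f g ⟩
  sum f + sum g            ≡⟨ sym (cong₂ _+_ (sumFin≡sum f) (sumFin≡sum g)) ⟩
  sumFin f + sumFin g      ∎
  where open ≡-Reasoning

*-distribˡ-sumFin : ∀ {n} c (f : Fin n → ℕ) → c * sumFin f ≡ sumFin (λ i → c * f i)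
*-distribˡ-sumFin c f = begin
  c * sumFin f             ≡⟨ cong (c *_) (sumFin≡sum f) ⟩
  c * sum f                ≡⟨ *-distribˡ-sum c f ⟩
  sum (λ i → c * f i)      ≡⟨ sym (sumFin≡sum (λ i → c * f i)) ⟩
  sumFin (λ i → c * f i)   ∎
  where open ≡-Reasoning

*-distribʳ-sumFin : ∀ {n} c (f : Fin n → ℕ) → sumFin f * c ≡ sumFin (λ i → f i * c)
*-distribʳ-sumFin c f = begin
  sumFin f * c             ≡⟨ cong (_* c) (sumFin≡sum f) ⟩
  sum f * c                ≡⟨ *-distribʳ-sum c f ⟩
  sum (λ i → f i * c)      ≡⟨ sym (sumFin≡sum (λ i → f i * c)) ⟩
  sumFin (λ i → f i * c)   ∎
  where open ≡-Reasoning

sumFin-comm : ∀ {a b} (f : Fin a → Fin b → ℕ) →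
  sumFin (λ i → sumFin (λ j → f i j)) ≡ sumFin (λ j → sumFin (λ i → f i j))
sumFin-comm f = begin
  sumFin (λ i → sumFin (λ j → f i j)) ≡⟨ sumFin-cong (λ i → sumFin≡sum (f i)) ⟩
  sumFin (λ i → sum (λ j → f i j))    ≡⟨ sumFin≡sum (λ i → sum (f i)) ⟩
  sum (λ i → sum (λ j → f i j))       ≡⟨ ∑-comm f ⟩
  sum (λ j → sum (λ i → f i j))       ≡⟨ sumFin≡sum (λ j → sum (λ i → f i j)) ⟨
  sumFin (λ j → sum (λ i → f i j))    ≡⟨ sumFin-cong (λ j → sumFin≡sum (λ i → f i j)) ⟨
  sumFin (λ j → sumFin (λ i → f i j)) ∎
  where open ≡-Reasoning

sumFin-δ : ∀ {n} (g : Fin n → ℕ) {v} (v<n : v < n) → sumFin (λ l → δ (toℕ l) v * g l) ≡ g (fromℕ< v<n)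
sumFin-δ {suc n} g {zero} _ =
  trans (cong₂ _+_ (ℕ.+-identityʳ (g F.zero)) (sumFin-zero n)) (ℕ.+-identityʳ (g F.zero))
sumFin-δ {suc n} g {suc v} (s≤s v<n) =
  trans (sumFin-cong (λ l → cong (_* g (F.suc l)) (δ-suc (toℕ l) v))) (sumFin-δ (λ l → g (F.suc l)) v<n)

sumFin-δ-toℕ : ∀ {n} (g : Fin n → ℕ) (i : Fin n) → sumFin (λ l → δ (toℕ l) (toℕ i) * g l) ≡ g i
sumFin-δ-toℕ g i = trans (sumFin-δ g (FP.toℕ<n i)) (cong g (FP.fromℕ<-toℕ i (FP.toℕ<n i)))

sumFin-δ-ℕ : ∀ {n} (h : ℕ → ℕ) {v} → v < n → sumFin {n} (λ l → δ (toℕ l) v * h (toℕ l)) ≡ h v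
sumFin-δ-ℕ h v<n = trans (sumFin-δ (λ l → h (toℕ l)) v<n) (cong h (FP.toℕ-fromℕ< v<n))

∣-sumFin : ∀ {d n} {f : Fin n → ℕ} → (∀ i → d ∣ f i) → d ∣ sumFin f
∣-sumFin {d} {zero} _ = d ∣0
∣-sumFin {n = suc n} d∣f = ∣m∣n⇒∣m+n (d∣f F.zero) (∣-sumFin (λ i → d∣f (F.suc i)))

Matrix : ℕ → ℕ → Set
Matrix a b = Fin a → Fin b → ℕ

infixl 7 _·_
infixl 6 _+ᴹ_
infix 4 _≐_

_·_ : ∀ {a b c} → Matrix a b → Matrix b c → Matrix a c
(A · B) i j = sumFin (λ k → A i k * B k j)

_+ᴹ_ : ∀ {a b} → Matrix a b → Matrix a b → Matrix a b
(A +ᴹ B) i j = A i j + B i j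

scalar : ∀ n → ℕ → Mat n
scalar n c i j = c * I n i j

_≐_ : ∀ {a b} → Matrix a b → Matrix a b → Set
A ≐ B = ∀ i j → A i j ≡ B i j

≐-setoid : ℕ → ℕ → Setoid _ _
≐-setoid a b = record
  { Carrier = Matrix a b ; _≈_ = _≐_
  ; isEquivalence = record
    { refl = λ i j → refl ; sym = λ e i j → sym (e i j) ; trans = λ e f i j → trans (e i j) (f i j) } }

module _ {a b : ℕ} where
  open Setoid (≐-setoid a b) public using ()
    renaming (refl to ≐-refl; sym to ≐-sym; trans to ≐-trans)

+ᴹ-cong : ∀ {a b} {A A′ B B′ : Matrix a b} → A ≐ A′ → B ≐ B′ → A +ᴹ B ≐ A′ +ᴹ B′
+ᴹ-cong A≐A′ B≐B′ i j = cong₂ _+_ (A≐A′ i j) (B≐B′ i j)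

·-congˡ : ∀ {a b c} (A : Matrix a b) {B B′ : Matrix b c} → B ≐ B′ → A · B ≐ A · B′
·-congˡ A B≐B′ i j = sumFin-cong (λ k → cong (A i k *_) (B≐B′ k j))

·-congʳ : ∀ {a b c} {A A′ : Matrix a b} (B : Matrix b c) → A ≐ A′ → A · B ≐ A′ · B
·-congʳ B A≐A′ i j = sumFin-cong (λ k → cong (_* B k j) (A≐A′ i k))

·-assoc : ∀ {a b c d} (A : Matrix a b) (B : Matrix b c) (C : Matrix c d) → (A · B) · C ≐ A · (B · C)
·-assoc A B C i j = begin
  sumFin (λ l → sumFin (λ k → A i k * B k l) * C l j)
    ≡⟨ sumFin-cong (λ l → *-distribʳ-sumFin (C l j) (λ k → A i k * B k l)) ⟩
  sumFin (λ l → sumFin (λ k → A i k * B k l * C l j))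
    ≡⟨ sumFin-comm (λ l k → A i k * B k l * C l j) ⟩
  sumFin (λ k → sumFin (λ l → A i k * B k l * C l j))
    ≡⟨ sumFin-cong (λ k → sumFin-cong (λ l → ℕ.*-assoc (A i k) (B k l) (C l j))) ⟩
  sumFin (λ k → sumFin (λ l → A i k * (B k l * C l j)))
    ≡⟨ sumFin-cong (λ k → sym (*-distribˡ-sumFin (A i k) (λ l → B k l * C l j))) ⟩
  sumFin (λ k → A i k * sumFin (λ l → B k l * C l j)) ∎
  where open ≡-Reasoning

·-distribˡ-+ᴹ : ∀ {a b c} (A : Matrix a b) (B C : Matrix b c) → A · (B +ᴹ C) ≐ A · B +ᴹ A · C
·-distribˡ-+ᴹ A B C i j =
  trans (sumFin-cong (λ k → ℕ.*-distribˡ-+ (A i k) (B k j) (C k j)))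
        (sumFin-distrib-+ (λ k → A i k * B k j) (λ k → A i k * C k j))

·-distribʳ-+ᴹ : ∀ {a b c} (A B : Matrix a b) (C : Matrix b c) → (A +ᴹ B) · C ≐ A · C +ᴹ B · C
·-distribʳ-+ᴹ A B C i j =
  trans (sumFin-cong (λ k → ℕ.*-distribʳ-+ (C k j) (A i k) (B i k)))
        (sumFin-distrib-+ (λ k → A i k * C k j) (λ k → B i k * C k j))

scalar-·ˡ : ∀ {n b} c (A : Matrix n b) → scalar n c · A ≐ (λ i j → c * A i j)
scalar-·ˡ {n} c A i j = begin
  sumFin (λ k → c * I n i k * A k j)   ≡⟨ sumFin-cong (λ k → ℕ.*-assoc c (I n i k) (A k j)) ⟩
  sumFin (λ k → c * (I n i k * A k j)) ≡⟨ sym (*-distribˡ-sumFin c (λ k → I n i k * A k j)) ⟩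
  c * sumFin (λ k → I n i k * A k j)   ≡⟨ cong (c *_) (trans (sumFin-cong (λ k → cong (_* A k j) (δ-sym (toℕ i) (toℕ k))))
                                                            (sumFin-δ-toℕ (λ k → A k j) i)) ⟩
  c * A i j                            ∎
  where open ≡-Reasoning

scalar-·ʳ : ∀ {n a} c (A : Matrix a n) → A · scalar n c ≐ (λ i j → A i j * c)
scalar-·ʳ {n} c A i j = begin
  sumFin (λ k → A i k * (c * I n k j)) ≡⟨ sumFin-cong (λ k → trans (ℕ.*-comm (A i k) (c * I n k j))
                                                  (cong (λ d → c * d * A i k) (δ-sym (toℕ k) (toℕ j)))) ⟩
  sumFin (λ k → c * I n j k * A i k)   ≡⟨ scalar-·ˡ c (λ k _ → A i k) j j ⟩
  c * A i j                            ≡⟨ ℕ.*-comm c (A i j) ⟩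
  A i j * c                            ∎
  where open ≡-Reasoning

^ᴹ-cong : ∀ {n} {A B : Mat n} k → A ≐ B → A ^ᴹ k ≐ B ^ᴹ k
^ᴹ-cong zero    A≐B = ≐-refl
^ᴹ-cong {A = A} {B} (suc k) A≐B = ≐-trans (·-congʳ (A ^ᴹ k) A≐B) (·-congˡ B (^ᴹ-cong k A≐B))

-- Polynomials evaluated at a matrix

infixl 6 _⊞_
infixl 7 _⊠_
infixr 8 _^ᵉ_

-- Polynomials are kept as syntax, so that one polynomial can be evaluated both at S n and at S N.
data Poly : Set where
  con      : ℕ → Poly
  var      : Poly
  _⊞_ _⊠_ : Poly → Poly → Poly

eval : ∀ {n} → Mat n → Poly → Mat n
eval {n} X (con c) = scalar n c
eval X var         = X
eval X (e ⊞ f)     = eval X e +ᴹ eval X f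
eval X (e ⊠ f)     = eval X e · eval X f

_^ᵉ_ : Poly → ℕ → Poly
e ^ᵉ zero  = con 1
e ^ᵉ suc k = e ⊠ e ^ᵉ k

eval-intertwine : ∀ {n N} {A : Mat n} {B : Mat N} {P : Matrix n N} →
  A · P ≐ P · B → ∀ e → eval A e · P ≐ P · eval B e
eval-intertwine {P = P} AP≐PB (con c) =
  ≐-trans (scalar-·ˡ c P) (≐-trans (λ i j → ℕ.*-comm c (P i j)) (≐-sym (scalar-·ʳ c P)))
eval-intertwine AP≐PB var = AP≐PB
eval-intertwine {A = A} {B} {P} AP≐PB (e ⊞ f) = begin
  (eval A e +ᴹ eval A f) · P      ≈⟨ ·-distribʳ-+ᴹ (eval A e) (eval A f) P ⟩
  eval A e · P +ᴹ eval A f · P    ≈⟨ +ᴹ-cong (eval-intertwine AP≐PB e) (eval-intertwine AP≐PB f) ⟩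
  P · eval B e +ᴹ P · eval B f    ≈⟨ ≐-sym (·-distribˡ-+ᴹ P (eval B e) (eval B f)) ⟩
  P · (eval B e +ᴹ eval B f)      ∎
  where open SetoidReasoning (≐-setoid _ _)
eval-intertwine {A = A} {B} {P} AP≐PB (e ⊠ f) = begin
  (eval A e · eval A f) · P       ≈⟨ ·-assoc (eval A e) (eval A f) P ⟩
  eval A e · (eval A f · P)       ≈⟨ ·-congˡ (eval A e) (eval-intertwine AP≐PB f) ⟩
  eval A e · (P · eval B f)       ≈⟨ ≐-sym (·-assoc (eval A e) P (eval B f)) ⟩
  (eval A e · P) · eval B f       ≈⟨ ·-congʳ (eval B f) (eval-intertwine AP≐PB e) ⟩
  (P · eval B e) · eval B f       ≈⟨ ·-assoc P (eval B e) (eval B f) ⟩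
  P · (eval B e · eval B f)       ∎
  where open SetoidReasoning (≐-setoid _ _)

eval-comm : ∀ {n} (X : Mat n) e f → eval X e · eval X f ≐ eval X f · eval X e
eval-comm X e f = eval-intertwine (≐-sym (eval-intertwine ≐-refl f)) e

eval-^ᵉ : ∀ {n} (X : Mat n) e k → eval X (e ^ᵉ k) ≐ eval X e ^ᴹ k
eval-^ᵉ X e zero    = λ i j → ℕ.*-identityˡ _
eval-^ᵉ X e (suc k) = ·-congˡ (eval X e) (eval-^ᵉ X e k)

geom : ℕ → Poly → Poly
geom zero    x = con 0
geom (suc k) x = geom k x ⊞ x ^ᵉ k

poly : (ℕ → ℕ) → ℕ → Poly → Poly
poly f zero    w = con 0
poly f (suc L) w = poly f L w ⊞ con (f L) ⊠ w ^ᵉ L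

poly-cong : ∀ {f g} → (∀ j → f j ≡ g j) → ∀ L w → poly f L w ≡ poly g L w
poly-cong f≗g zero    w = refl
poly-cong f≗g (suc L) w = cong₂ (λ e c → e ⊞ con c ⊠ w ^ᵉ L) (poly-cong f≗g L w) (f≗g L)

eval-geom : ∀ {n} (X : Mat n) k → eval X (geom k var) ≐ powSum X k
eval-geom X zero    = ≐-refl
eval-geom X (suc k) = +ᴹ-cong (eval-geom X k) (eval-^ᵉ X var k)

eval-T^ : ∀ n m k → eval (S n) (geom m var ^ᵉ k) ≐ T n m ^ᴹ k
eval-T^ n m k = ≐-trans (eval-^ᵉ (S n) (geom m var) k) (^ᴹ-cong k (eval-geom (S n) m))

-- Polynomials in a matrix, modulo p

module Modulo (p : ℕ) {{_ : NonZero p}} {n : ℕ} (X : Mat n) where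

  infix 4 _≈_
  -- A record rather than a definition, so that e and f stay inferable.
  record _≈_ (e f : Poly) : Set where
    constructor mk≈
    field entries : ∀ i j → eval X e i j % p ≡ eval X f i j % p
  open _≈_ public

  ≐⇒≈ : ∀ {e f} → eval X e ≐ eval X f → e ≈ f
  ≐⇒≈ e≐f = mk≈ (λ i j → cong (_% p) (e≐f i j))

  ⊟_ : Poly → Poly
  ⊟ e = con (p ∸ 1) ⊠ e

  private
    +-cong-% : ∀ {a a′ b b′} → a % p ≡ a′ % p → b % p ≡ b′ % p → (a + b) % p ≡ (a′ + b′) % p
    +-cong-% {a} {a′} {b} {b′} a≡a′ b≡b′ = begin
      (a + b) % p               ≡⟨ %-distribˡ-+ a b p ⟩
      (a % p + b % p) % p       ≡⟨ cong₂ (λ u v → (u + v) % p) a≡a′ b≡b′ ⟩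
      (a′ % p + b′ % p) % p     ≡⟨ %-distribˡ-+ a′ b′ p ⟨
      (a′ + b′) % p             ∎
      where open ≡-Reasoning

    *-cong-% : ∀ {a a′ b b′} → a % p ≡ a′ % p → b % p ≡ b′ % p → (a * b) % p ≡ (a′ * b′) % p
    *-cong-% {a} {a′} {b} {b′} a≡a′ b≡b′ = begin
      (a * b) % p               ≡⟨ %-distribˡ-* a b p ⟩
      (a % p * (b % p)) % p     ≡⟨ cong₂ (λ u v → (u * v) % p) a≡a′ b≡b′ ⟩
      (a′ % p * (b′ % p)) % p   ≡⟨ %-distribˡ-* a′ b′ p ⟨
      (a′ * b′) % p             ∎
      where open ≡-Reasoning

    sumFin-cong-% : ∀ {m} {f g : Fin m → ℕ} → (∀ k → f k % p ≡ g k % p) → sumFin f % p ≡ sumFin g % p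
    sumFin-cong-% {zero}  f≡g = refl
    sumFin-cong-% {suc m} f≡g = +-cong-% (f≡g F.zero) (sumFin-cong-% (λ k → f≡g (F.suc k)))

    ⊠-cong : ∀ {a a′ b b′} → a ≈ a′ → b ≈ b′ → a ⊠ b ≈ a′ ⊠ b′
    ⊠-cong a≈a′ b≈b′ = mk≈ (λ i j → sumFin-cong-% (λ k → *-cong-% (entries a≈a′ i k) (entries b≈b′ k j)))

  isCommutativeRing : IsCommutativeRing _≈_ _⊞_ _⊠_ ⊟_ (con 0) (con 1)
  isCommutativeRing = record
    { isRing = record
      { +-isAbelianGroup = record
        { isGroup = record
          { isMonoid = record
            { isSemigroup = record
              { isMagma = record
                { isEquivalence = record
                  { refl  = mk≈ (λ i j → refl)
                  ; sym   = λ e≈f → mk≈ (λ i j → sym (entries e≈f i j))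
                  ; trans = λ e≈f f≈g → mk≈ (λ i j → trans (entries e≈f i j) (entries f≈g i j)) }
                ; ∙-cong = λ a≈a′ b≈b′ → mk≈ (λ i j → +-cong-% (entries a≈a′ i j) (entries b≈b′ i j)) }
              ; assoc = λ a b c → ≐⇒≈ (λ i j → ℕ.+-assoc (eval X a i j) _ _) }
            ; identity = (λ a → ≐⇒≈ (λ i j → refl)) , (λ a → ≐⇒≈ (λ i j → ℕ.+-identityʳ (eval X a i j))) }
          ; inverse = (λ a → mk≈ (λ i j → trans (cong (_% p) (ℕ.+-comm _ (eval X a i j))) (⊟-inverse a i j)))
                    , (λ a → mk≈ (⊟-inverse a))
          ; ⁻¹-cong = ⊠-cong (mk≈ (λ i j → refl)) }
        ; comm = λ a b → ≐⇒≈ (λ i j → ℕ.+-comm (eval X a i j) _) }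
      ; *-cong = ⊠-cong
      ; *-assoc = λ a b c → ≐⇒≈ (·-assoc (eval X a) (eval X b) (eval X c))
      ; *-identity = (λ a → ≐⇒≈ (≐-trans (scalar-·ˡ 1 (eval X a)) (λ i j → ℕ.*-identityˡ _)))
                   , (λ a → ≐⇒≈ (≐-trans (scalar-·ʳ 1 (eval X a)) (λ i j → ℕ.*-identityʳ _)))
      ; distrib = (λ a b c → ≐⇒≈ (·-distribˡ-+ᴹ (eval X a) (eval X b) (eval X c)))
                , (λ a b c → ≐⇒≈ (·-distribʳ-+ᴹ (eval X b) (eval X c) (eval X a))) }
    ; *-comm = λ a b → ≐⇒≈ (eval-comm X a b) }
    where
    ⊟-inverse : ∀ a i j → (eval X a i j + eval X (⊟ a) i j) % p ≡ 0 % p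
    ⊟-inverse a i j = begin
      (x + eval X (⊟ a) i j) % p ≡⟨ cong (λ y → (x + y) % p) (scalar-·ˡ (p ∸ 1) (eval X a) i j) ⟩
      (suc (p ∸ 1) * x) % p      ≡⟨ cong (λ q → (q * x) % p) (ℕ.suc-pred p) ⟩
      (p * x) % p                ≡⟨ cong (_% p) (ℕ.*-comm p x) ⟩
      (x * p) % p                ≡⟨ m*n%n≡0 x p ⟩
      0                          ≡⟨ m*n%n≡0 0 p ⟨
      0 % p                      ∎
      where
      open ≡-Reasoning
      x = eval X a i j

  ring : CommutativeRing _ _
  ring = record { isCommutativeRing = isCommutativeRing }

  open CommutativeRing ring public
    using ( setoid; +-cong; +-congˡ; +-congʳ; *-cong; *-congˡ; *-congʳ; +-assoc
          ; +-identityˡ; +-identityʳ; *-assoc; *-comm; *-identityˡ; *-identityʳ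
          ; distribˡ; distribʳ; zeroˡ; zeroʳ )
    renaming (refl to ≈-refl; sym to ≈-sym; trans to ≈-trans; reflexive to ≈-reflexive)
  module ≈-Reasoning = SetoidReasoning setoid
  open ≈-Reasoning
  open import Algebra.Properties.Semiring.Exp (CommutativeRing.semiring ring) using (^-congˡ; ^-homo-*; ^-assocʳ) renaming (_^_ to _^ʳ_)
  open import Algebra.Properties.CommutativeSemiring.Exp (CommutativeRing.commutativeSemiring ring) using (^-distrib-*)
  open import Algebra.Properties.Group (CommutativeRing.+-group ring) using () renaming (∙-cancelˡ to +-cancelˡ)
  open import Algebra.Properties.CommutativeSemigroup (CommutativeRing.*-commutativeSemigroup ring) using (x∙yz≈y∙xz; x∙yz≈yx∙z)
  open import Algebra.Properties.CommutativeSemigroup (CommutativeRing.+-commutativeSemigroup ring) using () renaming (interchange to +-interchange)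
  open import Algebra.Properties.AbelianGroup (CommutativeRing.+-abelianGroup ring) using (xyx⁻¹≈y)

  +-*-regroup : ∀ a u g y → (a ⊞ u ⊠ g) ⊞ u ⊠ y ≈ a ⊞ u ⊠ (g ⊞ y)
  +-*-regroup a u g y = ≈-trans (+-assoc a (u ⊠ g) (u ⊠ y)) (+-congˡ (≈-sym (distribˡ u g y)))

  infixl 6 _⊟_
  _⊟_ : Poly → Poly → Poly
  e ⊟ f = e ⊞ ⊟ f

  -- _^ᵉ_ is defined independently of p and X, but it is syntactically the ring's power, whose laws are reused.
  ^ᵉ≡^ : ∀ e k → e ^ᵉ k ≡ e ^ʳ k
  ^ᵉ≡^ e zero    = refl
  ^ᵉ≡^ e (suc k) = cong (e ⊠_) (^ᵉ≡^ e k)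

  ^ᵉ-congˡ : ∀ {e f} k → e ≈ f → e ^ᵉ k ≈ f ^ᵉ k
  ^ᵉ-congˡ {e} {f} k e≈f rewrite ^ᵉ≡^ e k | ^ᵉ≡^ f k = ^-congˡ k e≈f

  ^ᵉ-homo-⊠ : ∀ e i j → e ^ᵉ (i + j) ≈ e ^ᵉ i ⊠ e ^ᵉ j
  ^ᵉ-homo-⊠ e i j rewrite ^ᵉ≡^ e (i + j) | ^ᵉ≡^ e i | ^ᵉ≡^ e j = ^-homo-* e i j

  ^ᵉ-assocʳ : ∀ e i j → (e ^ᵉ i) ^ᵉ j ≈ e ^ᵉ (i * j)
  ^ᵉ-assocʳ e i j rewrite ^ᵉ≡^ (e ^ᵉ i) j | ^ᵉ≡^ e i | ^ᵉ≡^ e (i * j) = ^-assocʳ e i j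

  ^ᵉ-distrib-⊠ : ∀ e f k → (e ⊠ f) ^ᵉ k ≈ e ^ᵉ k ⊠ f ^ᵉ k
  ^ᵉ-distrib-⊠ e f k rewrite ^ᵉ≡^ (e ⊠ f) k | ^ᵉ≡^ e k | ^ᵉ≡^ f k = ^-distrib-* e f k

  con-+ : ∀ a b → con (a + b) ≈ con a ⊞ con b
  con-+ a b = ≐⇒≈ (λ i j → ℕ.*-distribʳ-+ (I n i j) a b)

  con-* : ∀ a b → con (a * b) ≈ con a ⊠ con b
  con-* a b = ≐⇒≈ (≐-sym (≐-trans (scalar-·ˡ a (scalar n b)) (λ i j → sym (ℕ.*-assoc a b (I n i j)))))

  con-^ : ∀ c k → con c ^ᵉ k ≈ con (c ^ k)
  con-^ c zero    = ≈-refl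
  con-^ c (suc k) = ≈-trans (*-congˡ (con-^ c k)) (≈-sym (con-* c (c ^ k)))

  ≈0⇒∣ : ∀ {e} → e ≈ con 0 → ∀ i j → p ∣ eval X e i j
  ≈0⇒∣ e≈0 i j = m%n≡0⇒n∣m _ p (trans (entries e≈0 i j) (m*n%n≡0 0 p))

  ∣⇒≈0 : ∀ {e} → (∀ i j → p ∣ eval X e i j) → e ≈ con 0
  ∣⇒≈0 p∣e = mk≈ (λ i j → trans (n∣m⇒m%n≡0 _ p (p∣e i j)) (sym (m*n%n≡0 0 p)))

  con-∣ : ∀ {c} → p ∣ c → con c ≈ con 0
  con-∣ p∣c = ∣⇒≈0 (λ i j → ∣m⇒∣m*n (I n i j) p∣c)

  ^ᵉ-zero-mono : ∀ {e i j} → e ^ᵉ i ≈ con 0 → i ≤ j → e ^ᵉ j ≈ con 0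
  ^ᵉ-zero-mono {e} {i} {j} eⁱ≈0 i≤j = begin
    e ^ᵉ j               ≡⟨ cong (e ^ᵉ_) (ℕ.m+[n∸m]≡n i≤j) ⟨
    e ^ᵉ (i + (j ∸ i))   ≈⟨ ^ᵉ-homo-⊠ e i (j ∸ i) ⟩
    e ^ᵉ i ⊠ e ^ᵉ (j ∸ i) ≈⟨ *-congʳ eⁱ≈0 ⟩
    con 0 ⊠ e ^ᵉ (j ∸ i) ≈⟨ zeroˡ _ ⟩
    con 0                ∎

  geom-congʳ : ∀ k {x y} → x ≈ y → geom k x ≈ geom k y
  geom-congʳ zero    x≈y = ≈-refl
  geom-congʳ (suc k) x≈y = +-cong (geom-congʳ k x≈y) (^ᵉ-congˡ k x≈y)

  x≈1+[x-1] : ∀ x → x ≈ con 1 ⊞ (x ⊟ con 1)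
  x≈1+[x-1] x = ≈-sym (≈-trans (≈-sym (+-assoc (con 1) x (⊟ con 1))) (xyx⁻¹≈y (con 1) x))

  geom-telescope : ∀ {x u} k → x ≈ con 1 ⊞ u → x ^ᵉ k ≈ con 1 ⊞ u ⊠ geom k x
  geom-telescope {x} {u} zero    x≈1+u = ≈-sym (≈-trans (+-congˡ (zeroʳ u)) (+-identityʳ (con 1)))
  geom-telescope {x} {u} (suc k) x≈1+u = begin
    x ⊠ x ^ᵉ k                                  ≈⟨ *-congʳ x≈1+u ⟩
    (con 1 ⊞ u) ⊠ x ^ᵉ k                        ≈⟨ distribʳ (x ^ᵉ k) (con 1) u ⟩
    con 1 ⊠ x ^ᵉ k ⊞ u ⊠ x ^ᵉ k                 ≈⟨ +-congʳ (≈-trans (*-identityˡ (x ^ᵉ k)) (geom-telescope k x≈1+u)) ⟩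
    (con 1 ⊞ u ⊠ geom k x) ⊞ u ⊠ x ^ᵉ k         ≈⟨ +-*-regroup (con 1) u (geom k x) (x ^ᵉ k) ⟩
    con 1 ⊞ u ⊠ (geom k x ⊞ x ^ᵉ k)             ∎

  geom-+ : ∀ x i j → geom (i + j) x ≈ geom i x ⊞ x ^ᵉ i ⊠ geom j x
  geom-+ x i zero    = begin
    geom (i + 0) x                   ≡⟨ cong (λ k → geom k x) (ℕ.+-identityʳ i) ⟩
    geom i x                         ≈⟨ +-identityʳ (geom i x) ⟨
    geom i x ⊞ con 0                 ≈⟨ +-congˡ (zeroʳ (x ^ᵉ i)) ⟨
    geom i x ⊞ x ^ᵉ i ⊠ con 0        ∎
  geom-+ x i (suc j) = begin
    geom (i + suc j) x                                    ≡⟨ cong (λ k → geom k x) (ℕ.+-suc i j) ⟩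
    geom (i + j) x ⊞ x ^ᵉ (i + j)                         ≈⟨ +-cong (geom-+ x i j) (^ᵉ-homo-⊠ x i j) ⟩
    (geom i x ⊞ x ^ᵉ i ⊠ geom j x) ⊞ x ^ᵉ i ⊠ x ^ᵉ j      ≈⟨ +-*-regroup (geom i x) (x ^ᵉ i) (geom j x) (x ^ᵉ j) ⟩
    geom i x ⊞ x ^ᵉ i ⊠ (geom j x ⊞ x ^ᵉ j)               ∎

  geom-* : ∀ x i j → geom (j * i) x ≈ geom i x ⊠ geom j (x ^ᵉ i)
  geom-* x i zero    = ≈-sym (zeroʳ (geom i x))
  geom-* x i (suc j) = begin
    geom (i + j * i) x                                         ≡⟨ cong (λ k → geom k x) (ℕ.+-comm i (j * i)) ⟩
    geom (j * i + i) x                                         ≈⟨ geom-+ x (j * i) i ⟩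
    geom (j * i) x ⊞ x ^ᵉ (j * i) ⊠ geom i x                   ≈⟨ +-cong (geom-* x i j) (*-congʳ xʲⁱ) ⟩
    geom i x ⊠ geom j (x ^ᵉ i) ⊞ (x ^ᵉ i) ^ᵉ j ⊠ geom i x      ≈⟨ +-congˡ (*-comm ((x ^ᵉ i) ^ᵉ j) (geom i x)) ⟩
    geom i x ⊠ geom j (x ^ᵉ i) ⊞ geom i x ⊠ (x ^ᵉ i) ^ᵉ j      ≈⟨ distribˡ (geom i x) (geom j (x ^ᵉ i)) ((x ^ᵉ i) ^ᵉ j) ⟨
    geom i x ⊠ (geom j (x ^ᵉ i) ⊞ (x ^ᵉ i) ^ᵉ j)               ∎
    where
    xʲⁱ : x ^ᵉ (j * i) ≈ (x ^ᵉ i) ^ᵉ j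
    xʲⁱ = ≈-trans (≈-reflexive (cong (x ^ᵉ_) (ℕ.*-comm j i))) (≈-sym (^ᵉ-assocʳ x i j))

  poly-distrib-+ : ∀ f g L w → poly (λ j → f j + g j) L w ≈ poly f L w ⊞ poly g L w
  poly-distrib-+ f g zero    w = ≈-sym (+-identityʳ (con 0))
  poly-distrib-+ f g (suc L) w = begin
    poly (λ j → f j + g j) L w ⊞ con (f L + g L) ⊠ w ^ᵉ L
      ≈⟨ +-cong (poly-distrib-+ f g L w) (≈-trans (*-congʳ (con-+ (f L) (g L))) (distribʳ (w ^ᵉ L) (con (f L)) (con (g L)))) ⟩
    (poly f L w ⊞ poly g L w) ⊞ (con (f L) ⊠ w ^ᵉ L ⊞ con (g L) ⊠ w ^ᵉ L)
      ≈⟨ +-interchange (poly f L w) (poly g L w) _ _ ⟩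
    (poly f L w ⊞ con (f L) ⊠ w ^ᵉ L) ⊞ (poly g L w ⊞ con (g L) ⊠ w ^ᵉ L) ∎

  poly-unshift : ∀ f L w → poly f (suc L) w ≈ con (f 0) ⊞ w ⊠ poly (λ j → f (suc j)) L w
  poly-unshift f zero    w = ≈-trans (+-identityˡ _) (≈-trans (*-identityʳ _) (≈-sym (≈-trans (+-congˡ (zeroʳ w)) (+-identityʳ _))))
  poly-unshift f (suc L) w = begin
    poly f (suc L) w ⊞ con (f (suc L)) ⊠ w ^ᵉ suc L
      ≈⟨ +-congʳ (poly-unshift f L w) ⟩
    (con (f 0) ⊞ w ⊠ poly f′ L w) ⊞ con (f (suc L)) ⊠ (w ⊠ w ^ᵉ L)
      ≈⟨ +-congˡ (x∙yz≈y∙xz (con (f (suc L))) w (w ^ᵉ L)) ⟩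
    (con (f 0) ⊞ w ⊠ poly f′ L w) ⊞ w ⊠ (con (f (suc L)) ⊠ w ^ᵉ L)
      ≈⟨ +-*-regroup (con (f 0)) w (poly f′ L w) (con (f (suc L)) ⊠ w ^ᵉ L) ⟩
    con (f 0) ⊞ w ⊠ (poly f′ L w ⊞ con (f (suc L)) ⊠ w ^ᵉ L) ∎
    where
    f′ = λ j → f (suc j)

  poly-extend : ∀ f L w → f L ≡ 0 → poly f (suc L) w ≈ poly f L w
  poly-extend f L w fL≡0 = begin
    poly f L w ⊞ con (f L) ⊠ w ^ᵉ L ≡⟨ cong (λ c → poly f L w ⊞ con c ⊠ w ^ᵉ L) fL≡0 ⟩
    poly f L w ⊞ con 0 ⊠ w ^ᵉ L     ≈⟨ +-congˡ (zeroˡ (w ^ᵉ L)) ⟩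
    poly f L w ⊞ con 0              ≈⟨ +-identityʳ (poly f L w) ⟩
    poly f L w                      ∎

  poly-∣ : ∀ f L w → (∀ j → j < L → p ∣ f j) → poly f L w ≈ con 0
  poly-∣ f zero    w p∣f = ≈-refl
  poly-∣ f (suc L) w p∣f = begin
    poly f L w ⊞ con (f L) ⊠ w ^ᵉ L ≈⟨ +-cong (poly-∣ f L w (λ j j<L → p∣f j (ℕ.m<n⇒m<1+n j<L)))
                                              (≈-trans (*-congʳ (con-∣ (p∣f L (ℕ.n<1+n L)))) (zeroˡ (w ^ᵉ L))) ⟩
    con 0 ⊞ con 0                   ≈⟨ +-identityʳ (con 0) ⟩
    con 0                           ∎

  poly-pascal : ∀ i w → poly (λ j → i C suc j) i w ⊞ poly (i C_) (suc i) w ≈ poly (λ j → suc i C suc j) (suc i) w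
  poly-pascal i w = begin
    poly (λ j → i C suc j) i w ⊞ poly (i C_) (suc i) w
      ≈⟨ +-congʳ (poly-extend (λ j → i C suc j) i w (k>n⇒nCk≡0 (ℕ.n<1+n i))) ⟨
    poly (λ j → i C suc j) (suc i) w ⊞ poly (i C_) (suc i) w
      ≈⟨ poly-distrib-+ (λ j → i C suc j) (i C_) (suc i) w ⟨
    poly (λ j → i C suc j + i C j) (suc i) w
      ≡⟨ poly-cong (λ j → trans (ℕ.+-comm (i C suc j) (i C j)) (nCk+nC[k+1]≡[n+1]C[k+1] i j)) (suc i) w ⟩
    poly (λ j → suc i C suc j) (suc i) w ∎

  binomial : ∀ w i → (con 1 ⊞ w) ^ᵉ i ≈ poly (i C_) (suc i) w
  binomial w zero    = ≈-sym (≈-trans (+-identityˡ _) (*-identityˡ (con 1)))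
  binomial w (suc i) = begin
    (con 1 ⊞ w) ⊠ (con 1 ⊞ w) ^ᵉ i      ≈⟨ *-congˡ (binomial w i) ⟩
    (con 1 ⊞ w) ⊠ P                     ≈⟨ distribʳ P (con 1) w ⟩
    con 1 ⊠ P ⊞ w ⊠ P                   ≈⟨ +-congʳ (≈-trans (*-identityˡ P) (poly-unshift (i C_) i w)) ⟩
    (con 1 ⊞ w ⊠ Q) ⊞ w ⊠ P             ≈⟨ +-*-regroup (con 1) w Q P ⟩
    con 1 ⊞ w ⊠ (Q ⊞ P)                 ≈⟨ +-congˡ (*-congˡ (poly-pascal i w)) ⟩
    con 1 ⊞ w ⊠ poly (λ j → suc i C suc j) (suc i) w ≈⟨ poly-unshift (suc i C_) (suc i) w ⟨
    poly (suc i C_) (suc (suc i)) w     ∎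
    where
    P = poly (i C_) (suc i) w
    Q = poly (λ j → i C suc j) i w

  geom-hockey-stick : ∀ w i → geom i (con 1 ⊞ w) ≈ poly (λ j → i C suc j) i w
  geom-hockey-stick w zero    = ≈-refl
  geom-hockey-stick w (suc i) = ≈-trans (+-cong (geom-hockey-stick w i) (binomial w i)) (poly-pascal i w)

  infix 4 _≋_mod_
  _≋_mod_ : Poly → Poly → Poly → Set
  e ≋ f mod u = ∃[ d ] e ≈ f ⊞ u ⊠ d

  ≋-⊞ : ∀ {u e f e′ f′} → e ≋ f mod u → e′ ≋ f′ mod u → e ⊞ e′ ≋ f ⊞ f′ mod u
  ≋-⊞ {u} {f = f} {f′ = f′} (d , e≈) (d′ , e′≈) =
    d ⊞ d′ , ≈-trans (+-cong e≈ e′≈) (≈-trans (+-interchange f (u ⊠ d) f′ (u ⊠ d′)) (+-congˡ (≈-sym (distribˡ u d d′))))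

  ≋-⊠ : ∀ {u e f e′ f′} → e ≋ f mod u → e′ ≋ f′ mod u → e ⊠ e′ ≋ f ⊠ f′ mod u
  ≋-⊠ {u} {e} {f} {e′} {f′} (d , e≈) (d′ , e′≈) = f ⊠ d′ ⊞ d ⊠ h , (begin
    e ⊠ e′                              ≈⟨ *-cong e≈ e′≈ ⟩
    (f ⊞ u ⊠ d) ⊠ h                     ≈⟨ ≈-trans (distribʳ h f (u ⊠ d)) (+-congˡ (*-assoc u d h)) ⟩
    f ⊠ h ⊞ u ⊠ (d ⊠ h)                 ≈⟨ +-congʳ (≈-trans (distribˡ f f′ (u ⊠ d′)) (+-congˡ (x∙yz≈y∙xz f u d′))) ⟩
    (f ⊠ f′ ⊞ u ⊠ (f ⊠ d′)) ⊞ u ⊠ (d ⊠ h) ≈⟨ +-*-regroup (f ⊠ f′) u (f ⊠ d′) (d ⊠ h) ⟩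
    f ⊠ f′ ⊞ u ⊠ (f ⊠ d′ ⊞ d ⊠ h)       ∎)
    where
    h = f′ ⊞ u ⊠ d′

  ≋-^ᵉ : ∀ {u e f} → e ≋ f mod u → ∀ k → e ^ᵉ k ≋ f ^ᵉ k mod u
  ≋-^ᵉ {u} e≋f zero    = con 0 , ≈-sym (≈-trans (+-congˡ (zeroʳ u)) (+-identityʳ (con 1)))
  ≋-^ᵉ {u} e≋f (suc k) = ≋-⊠ e≋f (≋-^ᵉ e≋f k)

  con-suc : ∀ k → con k ⊞ con 1 ^ᵉ k ≈ con (suc k)
  con-suc k = begin
    con k ⊞ con 1 ^ᵉ k   ≈⟨ +-congˡ (con-^ 1 k) ⟩
    con k ⊞ con (1 ^ k)  ≡⟨ cong (λ c → con k ⊞ con c) (ℕ.^-zeroˡ k) ⟩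
    con k ⊞ con 1        ≈⟨ con-+ k 1 ⟨
    con (k + 1)          ≡⟨ cong con (ℕ.+-comm k 1) ⟩
    con (suc k)          ∎

  geom-one : ∀ k → geom k (con 1) ≈ con k
  geom-one zero    = ≈-refl
  geom-one (suc k) = ≈-trans (+-congʳ (geom-one k)) (con-suc k)

  geom-≋ : ∀ {u x} → x ≋ con 1 mod u → ∀ k → geom k x ≋ con k mod u
  geom-≋ {u} x≋1 zero    = con 0 , ≈-sym (≈-trans (+-congˡ (zeroʳ u)) (+-identityʳ (con 0)))
  geom-≋ {u} x≋1 (suc k) =
    let d , geom≈ = ≋-⊞ (geom-≋ x≋1 k) (≋-^ᵉ x≋1 k) in d , ≈-trans geom≈ (+-congʳ (con-suc k))

  geom-^ᵉ-≋ : ∀ {x u} → x ≈ con 1 ⊞ u → ∀ m e → geom m x ^ᵉ e ≋ con (m ^ e) mod u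
  geom-^ᵉ-≋ {x} {u} x≈1+u m e =
    let d , geomᵉ≈ = ≋-^ᵉ (geom-≋ x≋1 m) e in d , ≈-trans geomᵉ≈ (+-congʳ (con-^ m e))
    where
    x≋1 : x ≋ con 1 mod u
    x≋1 = con 1 , ≈-trans x≈1+u (+-congˡ (≈-sym (*-identityʳ u)))

  nilpotent-annihilates : ∀ {u g c s N} → u ^ᵉ suc N ≈ con 0 → s ≤ N →
                          u ^ᵉ s ⊠ g ≈ con 0 → g ≋ con c mod u → con c ⊠ u ^ᵉ N ≈ con 0
  nilpotent-annihilates {u} {g} {c} {s} {N} uᴺ⁺¹≈0 s≤N uˢg≈0 (d , g≈c+ud) = begin
    con c ⊠ u ^ᵉ N                           ≈⟨ +-identityʳ _ ⟨
    con c ⊠ u ^ᵉ N ⊞ con 0                   ≈⟨ +-congˡ (≈-trans (*-congʳ uᴺ⁺¹≈0) (zeroˡ d)) ⟨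
    con c ⊠ u ^ᵉ N ⊞ (u ⊠ u ^ᵉ N) ⊠ d        ≈⟨ +-cong (*-comm (con c) (u ^ᵉ N)) (≈-sym (x∙yz≈yx∙z (u ^ᵉ N) u d)) ⟩
    u ^ᵉ N ⊠ con c ⊞ u ^ᵉ N ⊠ (u ⊠ d)        ≈⟨ distribˡ (u ^ᵉ N) (con c) (u ⊠ d) ⟨
    u ^ᵉ N ⊠ (con c ⊞ u ⊠ d)                 ≈⟨ *-congˡ g≈c+ud ⟨
    u ^ᵉ N ⊠ g                               ≡⟨ cong (λ k → u ^ᵉ k ⊠ g) (ℕ.m∸n+n≡m s≤N) ⟨
    u ^ᵉ (N ∸ s + s) ⊠ g                     ≈⟨ *-congʳ (^ᵉ-homo-⊠ u (N ∸ s) s) ⟩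
    (u ^ᵉ (N ∸ s) ⊠ u ^ᵉ s) ⊠ g              ≈⟨ *-assoc _ _ g ⟩
    u ^ᵉ (N ∸ s) ⊠ (u ^ᵉ s ⊠ g)              ≈⟨ *-congˡ uˢg≈0 ⟩
    u ^ᵉ (N ∸ s) ⊠ con 0                     ≈⟨ zeroʳ _ ⟩
    con 0                                    ∎

  module _ (p-prime : Prime p) where

    private
      p₁ = pred p
      1+p₁≡p : suc p₁ ≡ p
      1+p₁≡p = ℕ.suc-pred p

    prime-binomial-sum : ∀ w → poly (λ j → suc p₁ C suc j) (suc p₁) w ≈ w ^ᵉ p₁
    prime-binomial-sum w = begin
      poly f p₁ w ⊞ con (suc p₁ C suc p₁) ⊠ w ^ᵉ p₁ ≈⟨ +-cong (poly-∣ f p₁ w p∣f)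
                                                              (*-congʳ (≈-reflexive (cong con (nCn≡1 (suc p₁))))) ⟩
      con 0 ⊞ con 1 ⊠ w ^ᵉ p₁                      ≈⟨ ≈-trans (+-identityˡ _) (*-identityˡ (w ^ᵉ p₁)) ⟩
      w ^ᵉ p₁                                      ∎
      where
      f = λ j → suc p₁ C suc j
      p∣f : ∀ j → j < p₁ → p ∣ f j
      p∣f j j<p₁ = subst (λ q → p ∣ q C suc j) (sym 1+p₁≡p)
                     (prime∣pCk p-prime (s≤s z≤n) (subst (suc j <_) 1+p₁≡p (s≤s j<p₁)))

    frobenius : ∀ w → (con 1 ⊞ w) ^ᵉ p ≈ con 1 ⊞ w ^ᵉ p
    frobenius w = begin
      (con 1 ⊞ w) ^ᵉ p                                       ≡⟨ cong ((con 1 ⊞ w) ^ᵉ_) 1+p₁≡p ⟨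
      (con 1 ⊞ w) ^ᵉ suc p₁                                  ≈⟨ binomial w (suc p₁) ⟩
      poly (suc p₁ C_) (suc (suc p₁)) w                      ≈⟨ poly-unshift (suc p₁ C_) (suc p₁) w ⟩
      con 1 ⊞ w ⊠ poly (λ j → suc p₁ C suc j) (suc p₁) w     ≈⟨ +-congˡ (*-congˡ (prime-binomial-sum w)) ⟩
      con 1 ⊞ w ^ᵉ suc p₁                                    ≡⟨ cong (λ k → con 1 ⊞ w ^ᵉ k) 1+p₁≡p ⟩
      con 1 ⊞ w ^ᵉ p                                         ∎

    geom-prime : ∀ w → geom p (con 1 ⊞ w) ≈ w ^ᵉ p₁
    geom-prime w = begin
      geom p (con 1 ⊞ w)                          ≡⟨ cong (λ k → geom k (con 1 ⊞ w)) 1+p₁≡p ⟨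
      geom (suc p₁) (con 1 ⊞ w)                   ≈⟨ geom-hockey-stick w (suc p₁) ⟩
      poly (λ j → suc p₁ C suc j) (suc p₁) w      ≈⟨ prime-binomial-sum w ⟩
      w ^ᵉ p₁                                     ∎

    frobenius-^ : ∀ a w → (con 1 ⊞ w) ^ᵉ (p ^ a) ≈ con 1 ⊞ w ^ᵉ (p ^ a)
    frobenius-^ zero    w = ≈-trans (*-identityʳ _) (+-congˡ (≈-sym (*-identityʳ w)))
    frobenius-^ (suc a) w = begin
      (con 1 ⊞ w) ^ᵉ (p * p ^ a)       ≈⟨ ^ᵉ-assocʳ (con 1 ⊞ w) p (p ^ a) ⟨
      ((con 1 ⊞ w) ^ᵉ p) ^ᵉ (p ^ a)    ≈⟨ ^ᵉ-congˡ (p ^ a) (frobenius w) ⟩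
      (con 1 ⊞ w ^ᵉ p) ^ᵉ (p ^ a)      ≈⟨ frobenius-^ a (w ^ᵉ p) ⟩
      con 1 ⊞ (w ^ᵉ p) ^ᵉ (p ^ a)      ≈⟨ +-congˡ (^ᵉ-assocʳ w p (p ^ a)) ⟩
      con 1 ⊞ w ^ᵉ (p * p ^ a)         ∎

    geom-prime-^ : ∀ a w → geom (p ^ a) (con 1 ⊞ w) ≈ w ^ᵉ (p ^ a ∸ 1)
    geom-prime-^ zero    w = +-identityˡ (con 1)
    geom-prime-^ (suc a) w = begin
      geom (p * p ^ a) x                          ≈⟨ geom-* x (p ^ a) p ⟩
      geom (p ^ a) x ⊠ geom p (x ^ᵉ p ^ a)        ≈⟨ *-cong (geom-prime-^ a w) (geom-congʳ p (frobenius-^ a w)) ⟩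
      w ^ᵉ (q ∸ 1) ⊠ geom p (con 1 ⊞ w ^ᵉ q)      ≈⟨ *-congˡ (geom-prime (w ^ᵉ q)) ⟩
      w ^ᵉ (q ∸ 1) ⊠ (w ^ᵉ q) ^ᵉ p₁               ≈⟨ *-congˡ (^ᵉ-assocʳ w q p₁) ⟩
      w ^ᵉ (q ∸ 1) ⊠ w ^ᵉ (q * p₁)                ≈⟨ ^ᵉ-homo-⊠ w (q ∸ 1) (q * p₁) ⟨
      w ^ᵉ ((q ∸ 1) + q * p₁)                     ≡⟨ cong (w ^ᵉ_) ([P∸1]+P*q≡[1+q]*P∸1 q p₁ (ℕ.m^n>0 p a)) ⟩
      w ^ᵉ (suc p₁ * q ∸ 1)                       ≡⟨ cong (λ r → w ^ᵉ (r * q ∸ 1)) 1+p₁≡p ⟩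
      w ^ᵉ (p * q ∸ 1)                            ∎
      where
      x = con 1 ⊞ w
      q = p ^ a

    unipotent⇒nilpotent : ∀ a {y} → y ^ᵉ (p ^ a) ≈ con 1 → (y ⊟ con 1) ^ᵉ (p ^ a) ≈ con 0
    unipotent⇒nilpotent a {y} yᵠ≈1 = +-cancelˡ (con 1) _ _ (begin
      con 1 ⊞ (y ⊟ con 1) ^ᵉ (p ^ a)     ≈⟨ frobenius-^ a (y ⊟ con 1) ⟨
      (con 1 ⊞ (y ⊟ con 1)) ^ᵉ (p ^ a)   ≈⟨ ^ᵉ-congˡ (p ^ a) (x≈1+[x-1] y) ⟨
      y ^ᵉ (p ^ a)                       ≈⟨ yᵠ≈1 ⟩
      con 1                              ≈⟨ +-identityʳ (con 1) ⟨
      con 1 ⊞ con 0                      ∎)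

    nilpotent⇒unipotent : ∀ {w} k → w ^ᵉ k ≈ con 0 → (con 1 ⊞ w) ^ᵉ (p ^ k) ≈ con 1
    nilpotent⇒unipotent {w} k wᵏ≈0 = begin
      (con 1 ⊞ w) ^ᵉ (p ^ k)   ≈⟨ frobenius-^ k w ⟩
      con 1 ⊞ w ^ᵉ (p ^ k)     ≈⟨ +-congˡ (^ᵉ-zero-mono wᵏ≈0 (ℕ.<⇒≤ (n<m^n (prime⇒1<p p-prime) k))) ⟩
      con 1 ⊞ con 0            ≈⟨ +-identityʳ (con 1) ⟩
      con 1                    ∎

    geom-split : ∀ {x v} m′ b → x ^ᵉ m′ ≈ con 1 ⊞ v → geom (m′ * p ^ b) x ≈ geom m′ x ⊠ v ^ᵉ (p ^ b ∸ 1)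
    geom-split {x} {v} m′ b xᵐ′≈1+v = begin
      geom (m′ * p ^ b) x                   ≡⟨ cong (λ k → geom k x) (ℕ.*-comm m′ (p ^ b)) ⟩
      geom (p ^ b * m′) x                   ≈⟨ geom-* x m′ (p ^ b) ⟩
      geom m′ x ⊠ geom (p ^ b) (x ^ᵉ m′)    ≈⟨ *-congˡ (geom-congʳ (p ^ b) xᵐ′≈1+v) ⟩
      geom m′ x ⊠ geom (p ^ b) (con 1 ⊞ v)  ≈⟨ *-congˡ (geom-prime-^ b v) ⟩
      geom m′ x ⊠ v ^ᵉ (p ^ b ∸ 1)          ∎

    geom-^-split : ∀ {x v} m′ b k → x ^ᵉ m′ ≈ con 1 ⊞ v →
                   geom (m′ * p ^ b) x ^ᵉ k ≈ geom m′ x ^ᵉ k ⊠ v ^ᵉ ((p ^ b ∸ 1) * k)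
    geom-^-split {x} {v} m′ b k xᵐ′≈1+v = begin
      geom (m′ * p ^ b) x ^ᵉ k                     ≈⟨ ^ᵉ-congˡ k (geom-split m′ b xᵐ′≈1+v) ⟩
      (geom m′ x ⊠ v ^ᵉ (p ^ b ∸ 1)) ^ᵉ k          ≈⟨ ^ᵉ-distrib-⊠ (geom m′ x) _ k ⟩
      geom m′ x ^ᵉ k ⊠ (v ^ᵉ (p ^ b ∸ 1)) ^ᵉ k     ≈⟨ *-congˡ (^ᵉ-assocʳ v (p ^ b ∸ 1) k) ⟩
      geom m′ x ^ᵉ k ⊠ v ^ᵉ ((p ^ b ∸ 1) * k)      ∎

    geom-^-factor : ∀ {x u} m′ b j → x ≈ con 1 ⊞ u →
                    geom (m′ * p ^ b) x ^ᵉ j ≈ u ^ᵉ ((p ^ b ∸ 1) * j) ⊠ geom m′ x ^ᵉ (j + (p ^ b ∸ 1) * j)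
    geom-^-factor {x} {u} m′ b j x≈1+u = begin
      geom (m′ * p ^ b) x ^ᵉ j    ≈⟨ geom-^-split m′ b j (geom-telescope m′ x≈1+u) ⟩
      G ^ᵉ j ⊠ (u ⊠ G) ^ᵉ s       ≈⟨ *-congˡ (^ᵉ-distrib-⊠ u G s) ⟩
      G ^ᵉ j ⊠ (u ^ᵉ s ⊠ G ^ᵉ s)  ≈⟨ x∙yz≈y∙xz (G ^ᵉ j) (u ^ᵉ s) (G ^ᵉ s) ⟩
      u ^ᵉ s ⊠ (G ^ᵉ j ⊠ G ^ᵉ s)  ≈⟨ *-congˡ (^ᵉ-homo-⊠ G j s) ⟨
      u ^ᵉ s ⊠ G ^ᵉ (j + s)       ∎
      where
      G = geom m′ x
      s = (p ^ b ∸ 1) * j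

-- The circulant matrix

module _ {n₀ : ℕ} where
  private
    n = suc n₀

  S-^ᴹ : ∀ t i j → (S n ^ᴹ t) i j ≡ δ (toℕ j) ((toℕ i + t) % n)
  S-^ᴹ zero    i j = begin
    δ (toℕ i) (toℕ j)              ≡⟨ δ-sym (toℕ i) (toℕ j) ⟩
    δ (toℕ j) (toℕ i)              ≡⟨ cong (δ (toℕ j)) (m<n⇒m%n≡m (FP.toℕ<n i)) ⟨
    δ (toℕ j) (toℕ i % n)          ≡⟨ cong (λ r → δ (toℕ j) (r % n)) (ℕ.+-identityʳ (toℕ i)) ⟨
    δ (toℕ j) ((toℕ i + 0) % n)    ∎
    where open ≡-Reasoning
  S-^ᴹ (suc t) i j = begin
    sumFin {n} (λ k → δ (toℕ k) (suc (toℕ i) % n) * (S n ^ᴹ t) k j)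
      ≡⟨ sumFin-cong {n} (λ k → cong (δ (toℕ k) (suc (toℕ i) % n) *_) (S-^ᴹ t k j)) ⟩
    sumFin {n} (λ k → δ (toℕ k) (suc (toℕ i) % n) * δ (toℕ j) ((toℕ k + t) % n))
      ≡⟨ sumFin-δ-ℕ {n} (λ r → δ (toℕ j) ((r + t) % n)) (m%n<n (suc (toℕ i)) n) ⟩
    δ (toℕ j) ((suc (toℕ i) % n + t) % n)
      ≡⟨ cong (δ (toℕ j)) ([m%n+o]%n≡[m+o]%n (suc (toℕ i)) t n) ⟩
    δ (toℕ j) ((suc (toℕ i) + t) % n)
      ≡⟨ cong (λ r → δ (toℕ j) (r % n)) (ℕ.+-suc (toℕ i) t) ⟨
    δ (toℕ j) ((toℕ i + suc t) % n) ∎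
    where open ≡-Reasoning

  S-^ᴹ-order : S n ^ᴹ n ≐ I n
  S-^ᴹ-order i j = begin
    (S n ^ᴹ n) i j              ≡⟨ S-^ᴹ n i j ⟩
    δ (toℕ j) ((toℕ i + n) % n) ≡⟨ cong (δ (toℕ j)) (trans ([m+n]%n≡m%n (toℕ i) n) (m<n⇒m%n≡m (FP.toℕ<n i))) ⟩
    δ (toℕ j) (toℕ i)           ≡⟨ δ-sym (toℕ j) (toℕ i) ⟩
    δ (toℕ i) (toℕ j)           ∎
    where open ≡-Reasoning

  powSum-S-00 : ∀ m → m < n → powSum (S n) (suc m) F.zero F.zero ≡ 1
  powSum-S-00 zero    _ = refl
  powSum-S-00 (suc m) m<n = cong₂ _+_ (powSum-S-00 m (ℕ.<-trans (ℕ.n<1+n m) m<n))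
    (trans (S-^ᴹ (suc m) F.zero F.zero) (cong (δ 0) (m<n⇒m%n≡m m<n)))

module Reduction {n₀ N₀ : ℕ} (N∣n : suc N₀ ∣ suc n₀) where
  private
    n = suc n₀
    N = suc N₀

  -- The projection ℤ_p[x]/(xⁿ − 1) → ℤ_p[x]/(x^N − 1), sending x^k to x^(k mod N).
  fold : Matrix n N
  fold k t = δ (toℕ k % N) (toℕ t)

  S·fold≐fold·S : S n · fold ≐ fold · S N
  S·fold≐fold·S k t = begin
    sumFin {n} (λ l → δ (toℕ l) (suc (toℕ k) % n) * δ (toℕ l % N) (toℕ t))
      ≡⟨ sumFin-δ-ℕ {n} (λ r → δ (r % N) (toℕ t)) (m%n<n (suc (toℕ k)) n) ⟩
    δ (suc (toℕ k) % n % N) (toℕ t)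
      ≡⟨ cong (λ r → δ r (toℕ t)) (trans (m∣n⇒o%n%m≡o%m N n (suc (toℕ k)) N∣n) (sym ([o+m%n]%n≡[o+m]%n 1 (toℕ k) N))) ⟩
    δ (suc (toℕ k % N) % N) (toℕ t)
      ≡⟨ δ-sym _ (toℕ t) ⟩
    δ (toℕ t) (suc (toℕ k % N) % N)
      ≡⟨ sumFin-δ-ℕ {N} (λ r → δ (toℕ t) (suc r % N)) (m%n<n (toℕ k) N) ⟨
    sumFin {N} (λ l → δ (toℕ l) (toℕ k % N) * δ (toℕ t) (suc (toℕ l) % N))
      ≡⟨ sumFin-cong {N} (λ l → cong (_* δ (toℕ t) (suc (toℕ l) % N)) (δ-sym (toℕ l) (toℕ k % N))) ⟩
    sumFin {N} (λ l → δ (toℕ k % N) (toℕ l) * δ (toℕ t) (suc (toℕ l) % N)) ∎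
    where open ≡-Reasoning

  ≈0-reduce : ∀ p {{_ : NonZero p}} e → Modulo._≈_ p (S n) e (con 0) → Modulo._≈_ p (S N) e (con 0)
  ≈0-reduce p e e≈0 = ModN.∣⇒≈0 (λ t j →
    subst (p ∣_) (fold-row t j) (∣-sumFin (λ l → ∣m⇒∣m*n (fold l j) (Modn.≈0⇒∣ e≈0 (lift t) l))))
    where
    module Modn = Modulo p (S n)
    module ModN = Modulo p (S N)
    lift : Fin N → Fin n
    lift t = F.inject≤ t (∣⇒≤ N∣n)
    fold-row : ∀ t j → (eval (S n) e · fold) (lift t) j ≡ eval (S N) e t j
    fold-row t j = begin
      (eval (S n) e · fold) (lift t) j                            ≡⟨ eval-intertwine {P = fold} S·fold≐fold·S e (lift t) j ⟩
      sumFin {N} (λ l → δ (toℕ (lift t) % N) (toℕ l) * eval (S N) e l j) ≡⟨ sumFin-cong (λ l → cong (_* eval (S N) e l j) (lift-t l)) ⟩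
      sumFin {N} (λ l → δ (toℕ l) (toℕ t) * eval (S N) e l j)          ≡⟨ sumFin-δ-toℕ (λ l → eval (S N) e l j) t ⟩
      eval (S N) e t j                                            ∎
      where
      open ≡-Reasoning
      lift-t : ∀ l → δ (toℕ (lift t) % N) (toℕ l) ≡ δ (toℕ l) (toℕ t)
      lift-t l = begin
        δ (toℕ (lift t) % N) (toℕ l) ≡⟨ cong (λ r → δ (r % N) (toℕ l)) (FP.toℕ-inject≤ t (∣⇒≤ N∣n)) ⟩
        δ (toℕ t % N) (toℕ l)        ≡⟨ cong (λ r → δ r (toℕ l)) (m<n⇒m%n≡m (FP.toℕ<n t)) ⟩
        δ (toℕ t) (toℕ l)            ≡⟨ δ-sym (toℕ t) (toℕ l) ⟩
        δ (toℕ l) (toℕ t)            ∎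

module Circulant {p : ℕ} (p-prime : Prime p) (n₀ : ℕ) where
  private
    instance _ = prime⇒nonZero p-prime
    n = suc n₀

  open Modulo p (S n) public

  T^ᴹ-zero⇔ : ∀ m k → ZeroMod p (T n m ^ᴹ k) ⇔ geom m var ^ᵉ k ≈ con 0
  T^ᴹ-zero⇔ m k = mk⇔
    (λ p∣T → ∣⇒≈0 (λ i j → subst (p ∣_) (sym (eval-T^ n m k i j)) (p∣T i j)))
    (λ Tᵏ≈0 i j → subst (p ∣_) (eval-T^ n m k i j) (≈0⇒∣ Tᵏ≈0 i j))

  varⁿ≈1 : var ^ᵉ n ≈ con 1
  varⁿ≈1 = ≐⇒≈ (≐-trans (eval-^ᵉ (S n) var n) (≐-trans S-^ᴹ-order (λ i j → sym (ℕ.*-identityˡ (I n i j)))))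

  var^≈1⇒n∣ : ∀ k → var ^ᵉ k ≈ con 1 → n ∣ k
  var^≈1⇒n∣ k xᵏ≈1 with k % n ≟ 0
  ... | yes k%n≡0 = m%n≡0⇒n∣m k n k%n≡0
  ... | no  k%n≢0 = ⊥-elim (ℕ.0≢1+n (begin
    0                                   ≡⟨ m*n%n≡0 0 p ⟨
    0 % p                               ≡⟨ cong (_% p) (trans (ℕ.*-identityˡ (I n F.zero j)) (δ-≢ 0≢j)) ⟨
    eval (S n) (con 1) F.zero j % p     ≡⟨ entries xᵏ≈1 F.zero j ⟨
    eval (S n) (var ^ᵉ k) F.zero j % p  ≡⟨ cong (_% p) (trans (eval-^ᵉ (S n) var k F.zero j) (S-^ᴹ k F.zero j)) ⟩
    δ (toℕ j) (k % n) % p               ≡⟨ cong (_% p) (δ-≡ (FP.toℕ-fromℕ< (m%n<n k n))) ⟩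
    1 % p                               ≡⟨ m<n⇒m%n≡m (prime⇒1<p p-prime) ⟩
    1                                   ∎))
    where
    open ≡-Reasoning
    j = fromℕ< (m%n<n k n)
    0≢j : 0 ≢ toℕ j
    0≢j 0≡j = k%n≢0 (trans (sym (FP.toℕ-fromℕ< (m%n<n k n))) (sym 0≡j))

  geom-^≈0 : ∀ {n′ a m m′ b k} → n ≡ n′ * p ^ a → m ≡ m′ * p ^ b → n′ ∣ m′ →
             p ^ a ≤ (p ^ b ∸ 1) * k → geom m var ^ᵉ k ≈ con 0
  geom-^≈0 {n′} {a} {b = b} {k} n≡n′*pᵃ refl (divides r refl) pᵃ≤s = begin
    geom (r * n′ * p ^ b) var ^ᵉ k     ≈⟨ geom-^-split p-prime (r * n′) b k varᵐ′≈1+ZW ⟩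
    G ^ᵉ k ⊠ (Z ⊠ W) ^ᵉ s              ≈⟨ *-congˡ (^ᵉ-distrib-⊠ Z W s) ⟩
    G ^ᵉ k ⊠ (Z ^ᵉ s ⊠ W ^ᵉ s)         ≈⟨ *-congˡ (*-congʳ (^ᵉ-zero-mono Zᵖᵃ≈0 pᵃ≤s)) ⟩
    G ^ᵉ k ⊠ (con 0 ⊠ W ^ᵉ s)          ≈⟨ *-congˡ (zeroˡ (W ^ᵉ s)) ⟩
    G ^ᵉ k ⊠ con 0                     ≈⟨ zeroʳ (G ^ᵉ k) ⟩
    con 0                              ∎
    where
    open ≈-Reasoning
    y = var ^ᵉ n′
    Z = y ⊟ con 1
    W = geom r y
    G = geom (r * n′) var
    s = (p ^ b ∸ 1) * k
    Zᵖᵃ≈0 : Z ^ᵉ (p ^ a) ≈ con 0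
    Zᵖᵃ≈0 = unipotent⇒nilpotent p-prime a (begin
      y ^ᵉ (p ^ a)        ≈⟨ ^ᵉ-assocʳ var n′ (p ^ a) ⟩
      var ^ᵉ (n′ * p ^ a) ≡⟨ cong (var ^ᵉ_) n≡n′*pᵃ ⟨
      var ^ᵉ n            ≈⟨ varⁿ≈1 ⟩
      con 1               ∎)
    varᵐ′≈1+ZW : var ^ᵉ (r * n′) ≈ con 1 ⊞ Z ⊠ W
    varᵐ′≈1+ZW = begin
      var ^ᵉ (r * n′)     ≡⟨ cong (var ^ᵉ_) (ℕ.*-comm r n′) ⟩
      var ^ᵉ (n′ * r)     ≈⟨ ^ᵉ-assocʳ var n′ r ⟨
      y ^ᵉ r              ≈⟨ geom-telescope r (x≈1+[x-1] y) ⟩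
      con 1 ⊞ Z ⊠ W       ∎

  geom-^≈0⇒n∣ : ∀ m k → geom m var ^ᵉ k ≈ con 0 → n ∣ m * p ^ k
  geom-^≈0⇒n∣ m k Tᵏ≈0 = var^≈1⇒n∣ (m * p ^ k) (begin
    var ^ᵉ (m * p ^ k)        ≈⟨ ^ᵉ-assocʳ var m (p ^ k) ⟨
    (var ^ᵉ m) ^ᵉ (p ^ k)     ≈⟨ ^ᵉ-congˡ (p ^ k) (geom-telescope m (x≈1+[x-1] var)) ⟩
    (con 1 ⊞ u ⊠ G) ^ᵉ (p ^ k) ≈⟨ nilpotent⇒unipotent p-prime k uGᵏ≈0 ⟩
    con 1                     ∎)
    where
    open ≈-Reasoning
    u = var ⊟ con 1
    G = geom m var
    uGᵏ≈0 : (u ⊠ G) ^ᵉ k ≈ con 0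
    uGᵏ≈0 = ≈-trans (^ᵉ-distrib-⊠ u G k) (≈-trans (*-congˡ Tᵏ≈0) (zeroʳ (u ^ᵉ k)))

  geom-^≉0 : ∀ {a m m′ b j} → n ≡ p ^ a → m ≡ m′ * p ^ b → ¬ p ∣ m′ →
             (p ^ b ∸ 1) * j < n → ¬ geom m var ^ᵉ j ≈ con 0
  geom-^≉0 {a} {m′ = m′} {b} {j} n≡pᵃ refl p∤m′ s<n Tʲ≈0 = p∤m′ (prime∣^⇒prime∣ p-prime m′ (j + s) p∣c)
    where
    open ≈-Reasoning
    u = var ⊟ con 1
    s = (p ^ b ∸ 1) * j
    c = m′ ^ (j + s)
    var≈1+u : var ≈ con 1 ⊞ u
    var≈1+u = x≈1+[x-1] var

    uⁿ≈0 : u ^ᵉ n ≈ con 0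
    uⁿ≈0 = subst (λ k → u ^ᵉ k ≈ con 0) (sym n≡pᵃ)
             (unipotent⇒nilpotent p-prime a (subst (λ k → var ^ᵉ k ≈ con 1) n≡pᵃ varⁿ≈1))

    uˢGʲ⁺ˢ≈0 : u ^ᵉ s ⊠ geom m′ var ^ᵉ (j + s) ≈ con 0
    uˢGʲ⁺ˢ≈0 = ≈-trans (≈-sym (geom-^-factor p-prime m′ b j var≈1+u)) Tʲ≈0

    c·geomⁿ≈0 : con c ⊠ geom n var ≈ con 0
    c·geomⁿ≈0 = begin
      con c ⊠ geom n var              ≡⟨ cong (λ k → con c ⊠ geom k var) n≡pᵃ ⟩
      con c ⊠ geom (p ^ a) var        ≈⟨ *-congˡ (geom-congʳ (p ^ a) var≈1+u) ⟩
      con c ⊠ geom (p ^ a) (con 1 ⊞ u) ≈⟨ *-congˡ (geom-prime-^ p-prime a u) ⟩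
      con c ⊠ u ^ᵉ (p ^ a ∸ 1)        ≡⟨ cong (λ k → con c ⊠ u ^ᵉ (k ∸ 1)) n≡pᵃ ⟨
      con c ⊠ u ^ᵉ n₀                 ≈⟨ nilpotent-annihilates uⁿ≈0 (s≤s⁻¹ s<n) uˢGʲ⁺ˢ≈0
                                                                (geom-^ᵉ-≋ var≈1+u m′ (j + s)) ⟩
      con 0                           ∎

    p∣c : p ∣ c
    p∣c = subst (p ∣_) c·geomⁿ₀₀≡c (≈0⇒∣ c·geomⁿ≈0 F.zero F.zero)
      where
      c·geomⁿ₀₀≡c : eval (S n) (con c ⊠ geom n var) F.zero F.zero ≡ c
      c·geomⁿ₀₀≡c = trans (scalar-·ˡ c (eval (S n) (geom n var)) F.zero F.zero)
        (trans (cong (c *_) (trans (eval-geom (S n) n F.zero F.zero) (powSum-S-00 n₀ (ℕ.n<1+n n₀)))) (ℕ.*-identityʳ c))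

module _ {p : ℕ} (p-prime : Prime p) where
  private
    instance _ = prime⇒nonZero p-prime

  geom-^≈0⇒p∣ : ∀ n₀ m k → Circulant._≈_ p-prime n₀ (geom m var ^ᵉ k) (con 0) → p ∣ m
  geom-^≈0⇒p∣ n₀ m k Tᵏ≈0 =
    prime∣^⇒prime∣ p-prime m k (subst (p ∣_) (ℕ.*-identityʳ (m ^ k)) (≈0⇒∣ mᵏ≈0 F.zero F.zero))
    where
    open Circulant p-prime 0
    open ≈-Reasoning
    var≈1 : var ≈ con 1
    var≈1 = ≈-trans (≈-sym (*-identityʳ var)) varⁿ≈1
    mᵏ≈0 : con (m ^ k) ≈ con 0
    mᵏ≈0 = begin
      con (m ^ k)            ≈⟨ con-^ m k ⟨
      con m ^ᵉ k             ≈⟨ ^ᵉ-congˡ k (≈-trans (geom-congʳ m var≈1) (geom-one m)) ⟨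
      geom m var ^ᵉ k        ≈⟨ Reduction.≈0-reduce (1∣ suc n₀) p (geom m var ^ᵉ k) Tᵏ≈0 ⟩
      con 0                  ∎

  geom-^≉0-reduce : ∀ n₀ {n′ a m m′ b j} → suc n₀ ≡ n′ * p ^ a → m ≡ m′ * p ^ b → ¬ p ∣ m′ →
                    (p ^ b ∸ 1) * j < p ^ a → ¬ Circulant._≈_ p-prime n₀ (geom m var ^ᵉ j) (con 0)
  geom-^≉0-reduce n₀ {n′} {a} {m} {b = b} {j} n≡n′*pᵃ m≡m′*pᵇ p∤m′ s<pᵃ Tʲ≈0 =
    Circulant.geom-^≉0 p-prime (pred (p ^ a)) {a} {b = b} 1+N₀≡pᵃ m≡m′*pᵇ p∤m′ (subst (_ <_) (sym 1+N₀≡pᵃ) s<pᵃ)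
      (Reduction.≈0-reduce pᵃ∣n p (geom m var ^ᵉ j) Tʲ≈0)
    where
    1+N₀≡pᵃ : suc (pred (p ^ a)) ≡ p ^ a
    1+N₀≡pᵃ = ℕ.suc-pred (p ^ a) {{ℕ.m^n≢0 p a}}
    pᵃ∣n : suc (pred (p ^ a)) ∣ suc n₀
    pᵃ∣n = subst (_∣ suc n₀) (sym 1+N₀≡pᵃ) (divides n′ n≡n′*pᵃ)

  nilpotency-index : ∀ n₀ {n′ a m m′ b} → suc n₀ ≡ n′ * p ^ a → ¬ p ∣ n′ → m ≡ m′ * p ^ b → ¬ p ∣ m′ →
                     p ∣ m → ∃[ K ] (suc n₀ ∣ m * p ^ K) →
                     NilIndexMod p (T (suc n₀) m) (ceilDiv (p ^ a) (p ^ b ∸ 1))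
  nilpotency-index n₀ {n′} {a} {m} {m′} {b} n≡n′*pᵃ p∤n′ m≡m′*pᵇ p∤m′ p∣m (K , n∣m*pᴷ) =
    ceilDiv-pos {p ^ a} (ℕ.m^n>0 p a) 0<D , Tᵏ≡0 , below
    where
    open Circulant p-prime n₀
    D = p ^ b ∸ 1
    k = ceilDiv (p ^ a) D

    0<D : 0 < D
    0<D = 0<pᵇ∸1 p-prime b (p∣m⇒0<b p-prime b m≡m′*pᵇ p∤m′ p∣m)

    n′∣m′ : n′ ∣ m′
    n′∣m′ = coprime-divisor-^ p-prime m′ (b + K) p∤n′ (∣-trans n′∣n (subst (suc n₀ ∣_) m*pᴷ≡m′*pᵇ⁺ᴷ n∣m*pᴷ))
      where
      n′∣n : n′ ∣ suc n₀
      n′∣n = divides (p ^ a) (trans n≡n′*pᵃ (ℕ.*-comm n′ (p ^ a)))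
      m*pᴷ≡m′*pᵇ⁺ᴷ : m * p ^ K ≡ m′ * p ^ (b + K)
      m*pᴷ≡m′*pᵇ⁺ᴷ = trans (cong (_* p ^ K) m≡m′*pᵇ)
                       (trans (ℕ.*-assoc m′ (p ^ b) (p ^ K)) (cong (m′ *_) (sym (ℕ.^-distribˡ-+-* p b K))))

    Tᵏ≡0 : ZeroMod p (T (suc n₀) m ^ᴹ k)
    Tᵏ≡0 = Equivalence.from (T^ᴹ-zero⇔ m k)
             (geom-^≈0 {a = a} {b = b} {k} n≡n′*pᵃ m≡m′*pᵇ n′∣m′ (subst (p ^ a ≤_) (ℕ.*-comm k D) (≤ceilDiv* {p ^ a} 0<D)))

    below : ∀ j → 0 < j → j < k → ¬ ZeroMod p (T (suc n₀) m ^ᴹ j)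
    below j _ j<k Tʲ≡0 = geom-^≉0-reduce n₀ {n′} {a} {m} {m′} {b} {j} n≡n′*pᵃ m≡m′*pᵇ p∤m′
      (subst (_< p ^ a) (ℕ.*-comm j D) (<ceilDiv⇒*< {p ^ a} 0<D j j<k)) (Equivalence.to (T^ᴹ-zero⇔ m j) Tʲ≡0)

theorem1 : (n m p : ℕ) → 0 < n → 0 < m → Prime p →
    (NilpotentMod p (T n m) ⇔ (p ∣ m × ∃[ k ] (n ∣ m * p ^ k)))
    × (p ∣ m → (∃[ k ] (n ∣ m * p ^ k)) →
         (a b : ℕ) → IsMaxPowDiv p n a → IsMaxPowDiv p m b →
         NilIndexMod p (T n m) (ceilDiv (p ^ a) (p ^ b ∸ 1)))
theorem1 (suc n₀) m@(suc _) p _ _ p-prime = mk⇔ nilpotent⇒ ⇒nilpotent , index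
  where
  open Circulant p-prime n₀ using (T^ᴹ-zero⇔; geom-^≈0⇒n∣)

  index : p ∣ m → ∃[ k ] (suc n₀ ∣ m * p ^ k) → ∀ a b → IsMaxPowDiv p (suc n₀) a → IsMaxPowDiv p m b →
          NilIndexMod p (T (suc n₀) m) (ceilDiv (p ^ a) (p ^ b ∸ 1))
  index p∣m n∣m*pᵏ a b maxᵃ maxᵇ =
    let n′ , n≡n′*pᵃ , p∤n′ = maxPowDiv-split a maxᵃ
        m′ , m≡m′*pᵇ , p∤m′ = maxPowDiv-split b maxᵇ
    in nilpotency-index p-prime n₀ {a = a} {b = b} n≡n′*pᵃ p∤n′ m≡m′*pᵇ p∤m′ p∣m n∣m*pᵏ

  nilpotent⇒ : NilpotentMod p (T (suc n₀) m) → p ∣ m × ∃[ k ] (suc n₀ ∣ m * p ^ k)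
  nilpotent⇒ (k , _ , Tᵏ≡0) = geom-^≈0⇒p∣ p-prime n₀ m k Tᵏ≈0 , k , geom-^≈0⇒n∣ m k Tᵏ≈0
    where Tᵏ≈0 = Equivalence.to (T^ᴹ-zero⇔ m k) Tᵏ≡0

  ⇒nilpotent : p ∣ m × ∃[ k ] (suc n₀ ∣ m * p ^ k) → NilpotentMod p (T (suc n₀) m)
  ⇒nilpotent (p∣m , n∣m*pᵏ) =
    let a , n′ , n≡n′*pᵃ , p∤n′ = p-free-part p-prime (suc n₀) (s≤s z≤n)
        b , m′ , m≡m′*pᵇ , p∤m′ = p-free-part p-prime m (s≤s z≤n)
        0<k , Tᵏ≡0 , _ = nilpotency-index p-prime n₀ {a = a} {b = b} n≡n′*pᵃ p∤n′ m≡m′*pᵇ p∤m′ p∣m n∣m*pᵏ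
    in _ , 0<k , Tᵏ≡0
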